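{- For any signature $S$: (i) the labeling $\lambda$ is an EL-labeling of the poset $(T(S),\preceq)$; (ii) between any two elements $t_1\preceq t_2$ of this poset there is at most one $\lambda$-weakly decreasing saturated chain.
   Context: A signature is a set $S$ with an arity map $|\cdot|:S\to\mathbb N$. An $S$-term is either the leaf $\ell$ or $s\,t_1\cdots t_{|s|}$ with $s\in S$ and $S$-terms $t_i$; $T(S)$ is the set of $S$-terms. Preorder traversal: root, then subterms left to right recursively. Internal nodes are numbered $1,\dots,\deg t$ in preorder; $\mathrm{dc}(t)$ is the word of their decorations. Children (leaves included) are numbered from $1$ left to right. An edge of $t$ is a triple $(i_1,j,i_2)$ of internal nodes with $i_2$ the $j$-th child of $i_1$; by convention $(1,0,1)$ is also an edge when $\deg t\ge1$. Each internal node $i$ has a unique parent edge $(\mathrm{pa}(i),\mathrm{lp}(i),i)$. Connection word: $\mathrm{cnc}(t)(i)=\mathrm{pa}(i)+1-2^{\mathrm{lp}(i)-a}$, $a$ the arity of the decoration of $\mathrm{pa}(i)$. Order: $t_1\preceq t_2$ iff $\mathrm{dc}(t_1)=\mathrm{dc}(t_2)$ and $\mathrm{cnc}(t_1)\le\mathrm{cnc}(t_2)$ componentwise. For $i\ge1$, $t_1\to_i t_2$ when node $i$ of $t_1$ is visited immediately after a leaf $x$ in preorder and $t_2$ is obtained by detaching the subterm rooted at $i$ (a leaf replacing it) and grafting it in place of $x$; $\to=\bigcup_i\to_i$, which is the covering relation of $\preceq$. When $t_1\to t_2$, exactly one edge $(i_1,j_1,i)$ of $t_1$ is not an edge of $t_2$,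 and the labeling is $\lambda(t_1,t_2):=(i,i_1,-j_1)\in\mathbb Z^3$, with $\mathbb Z^3$ ordered lexicographically. For a saturated chain $c=(c_1,\dots,c_k)$, $\bar\lambda(c)$ is the word $\lambda(c_1,c_2)\cdots\lambda(c_{k-1},c_k)$. The chain is $\lambda$-increasing (resp. $\lambda$-weakly decreasing) if this word is strictly increasing (resp. weakly decreasing), and $c$ is $\lambda$-smaller than $c'$ if $\bar\lambda(c)$ is lexicographically smaller than $\bar\lambda(c')$. $\lambda$ is an EL-labeling if for all $x\preceq x'$ there is exactly one $\lambda$-increasing saturated chain from $x$ to $x'$, and it is $\lambda$-smaller than every other saturated chain from $x$ to $x'$. -}

module Defs where

open import Data.Nat as ℕ using (ℕ; zero; suc; _+_; _∸_; _^_; _≡ᵇ_)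
open import Data.Nat.Properties using (m^n≢0)
open import Data.Integer as ℤ using (ℤ; +_; -_)
open import Data.Rational as ℚ using (ℚ)
open import Data.Bool using (Bool; true; false; _∧_; _∨_; not; if_then_else_)
open import Data.List using (List; []; _∷_; _++_; map; filterᵇ)
open import Data.Vec using (Vec; []; _∷_)
open import Data.Maybe using (Maybe; just; nothing)
open import Data.Product using (Σ; _×_; _,_; ∃-syntax)
open import Data.Sum using (_⊎_)
open import Relation.Binary.PropositionalEquality using (_≡_)
open import Data.List.Relation.Binary.Pointwise using (Pointwise)
open import Data.List.Relation.Binary.Lex.Strict using (Lex-<)
open import Data.Product.Relation.Binary.Lex.Strict using (×-Lex)
open import Data.List.Relation.Unary.Linked using (Linked)

record Signature : Set₁ where
  field
    S     : Set
    arity : S → ℕ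
open Signature public

data Term (Sig : Signature) : Set where
  leaf : Term Sig
  node : (s : S Sig) → Vec (Term Sig) (arity Sig s) → Term Sig

module _ {Sig : Signature} where

  mutual
    deg : Term Sig → ℕ
    deg leaf        = 0
    deg (node s ts) = suc (degs ts)

    degs : ∀ {k} → Vec (Term Sig) k → ℕ
    degs []       = 0
    degs (t ∷ ts) = deg t + degs ts

  -- Data attached to each internal node i (1-based preorder index):
  -- its decoration, and its parent edge (pa(i), lp(i), i) together with
  -- the arity a of the decoration of pa(i).
  record NodeInfo : Set where
    constructor nodeInfo
    field
      dec : S Sig
      pa  : ℕ
      lp  : ℕ
      par : ℕ   -- arity of the decoration of pa(i)
      idx : ℕ
  open NodeInfo public

  -- Preorder traversal listing the internal nodes.
  -- Arguments: parent index, child position (lp), parent arity, index of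
  -- the current node if it is internal.
  mutual
    infoAux : ℕ → ℕ → ℕ → ℕ → Term Sig → List NodeInfo
    infoAux p j a n leaf        = []
    infoAux p j a n (node s ts) =
      nodeInfo s p j a n ∷ infoAuxs n (arity Sig s) 1 (suc n) ts

    -- children of node p (arity a), starting at child position j, next
    -- free preorder index n
    infoAuxs : ∀ {k} → ℕ → ℕ → ℕ → ℕ → Vec (Term Sig) k → List NodeInfo
    infoAuxs p a j n []       = []
    infoAuxs p a j n (t ∷ ts) =
      infoAux p j a n t ++ infoAuxs p a (suc j) (n + deg t) ts

  -- The root has the conventional parent edge (1,0,1).
  nodeInfos : Term Sig → List NodeInfo
  nodeInfos leaf        = []
  nodeInfos (node s ts) = infoAux 1 0 (arity Sig s) 1 (node s ts)

  dc : Term Sig → List (S Sig)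
  dc t = map dec (nodeInfos t)

  -- pa + 1 - 2^(lp - a), where lp ≤ a, i.e. pa + 1 - 1 / 2^(a - lp)
  cncValue : NodeInfo → ℚ
  cncValue x =
    (+ (pa x + 1)) ℚ./ 1 ℚ.- ℚ._/_ (+ 1) (2 ^ (par x ∸ lp x)) {{m^n≢0 2 (par x ∸ lp x)}}

  cnc : Term Sig → List ℚ
  cnc t = map cncValue (nodeInfos t)

  _⪯_ : Term Sig → Term Sig → Set
  t₁ ⪯ t₂ = (dc t₁ ≡ dc t₂) × Pointwise ℚ._≤_ (cnc t₁) (cnc t₂)

  -- Edges (i₁, j, i₂); includes (1,0,1) when deg t ≥ 1.
  Edge : Set
  Edge = ℕ × ℕ × ℕ

  edges : Term Sig → List Edge
  edges t = map (λ x → (pa x , lp x , idx x)) (nodeInfos t)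

  edgeEq : Edge → Edge → Bool
  edgeEq (a , b , c) (a' , b' , c') = (a ≡ᵇ a') ∧ (b ≡ᵇ b') ∧ (c ≡ᵇ c')

  memberᵇ : Edge → List Edge → Bool
  memberᵇ e []       = false
  memberᵇ e (f ∷ fs) = edgeEq e f ∨ memberᵇ e fs

  -- Positions (addresses) of all nodes, leaves included: lists of
  -- 0-based child positions.
  Addr : Set
  Addr = List ℕ

  mutual
    subAt : Term Sig → Addr → Maybe (Term Sig)
    subAt t           []      = just t
    subAt leaf        (k ∷ p) = nothing
    subAt (node s ts) (k ∷ p) = subAts ts k p

    subAts : ∀ {m} → Vec (Term Sig) m → ℕ → Addr → Maybe (Term Sig)
    subAts []       k       p = nothing
    subAts (t ∷ ts) zero    p = subAt t p
    subAts (t ∷ ts) (suc k) p = subAts ts k p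

  -- replace the subterm at an address (no-op on invalid addresses)
  mutual
    replaceAt : Term Sig → Addr → Term Sig → Term Sig
    replaceAt t           []      u = u
    replaceAt leaf        (k ∷ p) u = leaf
    replaceAt (node s ts) (k ∷ p) u = node s (replaceAts ts k p u)

    replaceAts : ∀ {m} → Vec (Term Sig) m → ℕ → Addr → Term Sig → Vec (Term Sig) m
    replaceAts []       k       p u = []
    replaceAts (t ∷ ts) zero    p u = replaceAt t p u ∷ ts
    replaceAts (t ∷ ts) (suc k) p u = t ∷ replaceAts ts k p u

  mutual
    preorder : Term Sig → List Addr
    preorder leaf        = [] ∷ []
    preorder (node s ts) = [] ∷ preorders 0 ts

    preorders : ∀ {m} → ℕ → Vec (Term Sig) m → List Addr
    preorders k []       = []
    preorders k (t ∷ ts) = map (k ∷_) (preorder t) ++ preorders (suc k) ts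

  IsNode : Term Sig → Set
  IsNode t = Σ (S Sig) λ s → Σ (Vec (Term Sig) (arity Sig s)) λ ts → t ≡ node s ts

  -- t₁ → t₂ : an internal node (at address q) visited immediately after a
  -- leaf x (at address p) in preorder; t₂ is obtained by detaching the
  -- subterm at q (a leaf replacing it) and grafting it in place of x.
  -- (This is the union over i of the relations →ᵢ.)
  _⟶_ : Term Sig → Term Sig → Set
  t₁ ⟶ t₂ =
    Σ Addr λ p → Σ Addr λ q → Σ (List Addr) λ xs → Σ (List Addr) λ ys →
    Σ (Term Sig) λ u →
      (preorder t₁ ≡ xs ++ p ∷ q ∷ ys)
    × (subAt t₁ p ≡ just leaf)
    × (subAt t₁ q ≡ just u)
    × IsNode u
    × (t₂ ≡ replaceAt (replaceAt t₁ q leaf) p u)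

  Label : Set
  Label = ℤ × ℤ × ℤ

  _<ᴸ_ : Label → Label → Set
  _<ᴸ_ = ×-Lex _≡_ ℤ._<_ (×-Lex _≡_ ℤ._<_ ℤ._<_)

  _≤ᴸ_ : Label → Label → Set
  x ≤ᴸ y = (x <ᴸ y) ⊎ (x ≡ y)

  -- λ(t₁,t₂) = (i, i₁, -j₁) for the edge (i₁,j₁,i) of t₁ which is not an
  -- edge of t₂ (unique when t₁ → t₂; default (0,0,0) otherwise).
  label : Term Sig → Term Sig → Label
  label t₁ t₂ with filterᵇ (λ e → not (memberᵇ e (edges t₂))) (edges t₁)
  ... | []                  = (+ 0 , + 0 , + 0)
  ... | (i₁ , j₁ , i) ∷ _   = (+ i , + i₁ , - (+ j₁))

  data SatChain : Term Sig → Term Sig → List (Term Sig) → Set where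
    single : ∀ {t} → SatChain t t (t ∷ [])
    step   : ∀ {t₁ t₂ t₃ cs} → t₁ ⟶ t₂ → SatChain t₂ t₃ cs →
             SatChain t₁ t₃ (t₁ ∷ cs)

  labels : List (Term Sig) → List Label
  labels (a ∷ b ∷ cs) = label a b ∷ labels (b ∷ cs)
  labels _            = []

  λ-increasing : List (Term Sig) → Set
  λ-increasing c = Linked _<ᴸ_ (labels c)

  λ-weaklyDecreasing : List (Term Sig) → Set
  λ-weaklyDecreasing c = Linked (λ a b → b ≤ᴸ a) (labels c)

  λ-smaller : List (Term Sig) → List (Term Sig) → Set
  λ-smaller c c' = Lex-< _≡_ _<ᴸ_ (labels c) (labels c')

  IsEL-labeling : Set
  IsEL-labeling =
    ∀ x x' → x ⪯ x' →
      Σ (List (Term Sig)) λ c →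
          SatChain x x' c
        × λ-increasing c
        × (∀ c' → SatChain x x' c' → λ-increasing c' → c' ≡ c)
        × (∀ c' → SatChain x x' c' → c' ≢ c → λ-smaller c c')
    where open import Relation.Binary.PropositionalEquality using (_≢_)

  AtMostOneWeaklyDecreasing : Set
  AtMostOneWeaklyDecreasing =
    ∀ x x' → x ⪯ x' → ∀ c c' →
      SatChain x x' c → λ-weaklyDecreasing c →
      SatChain x x' c' → λ-weaklyDecreasing c' → c ≡ c'

-- Encode a term by its preorder word (○ for a leaf, ● s for a node). Reading the word with a stack of pending
-- child slots (parent, position, arity) recovers the decoration and parent edge of every node, and connection
-- values of slots strictly increase towards the top of the stack. A move swaps a leaf with the node following it,
-- so it only reattaches that node, say node p + 1, from the second slot of the stack to the top one: coordinate p
-- of the connection word strictly increases, all others stay, and the label records p + 1 and the old slot.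
-- Positions never decrease along an increasing chain, so the coordinates left of its first position are already
-- final. Comparing x ⪯ y node by node, the first difference is a leaf of x facing a node of y; the move at the
-- last leaf before the next node of x is then the only possible first step of an increasing chain to y, and it
-- has the least label. Iterating it (each move removes a leaf-before-node inversion) gives the chain, and since
-- a step is determined by its position it is unique and lexicographically least. Dually, a weakly decreasing
-- chain never changes positions right of its first one, which again forces its first step.

module Submission where

open import Defs
open import Data.Product using (_×_)

open import Data.Nat as ℕ using (ℕ; zero; suc; _+_; _∸_; _^_; _≡ᵇ_; _≤_; _<_; z≤n; s≤s)
import Data.Nat.Properties as NP
import Data.Nat.GCD as GCD
open import Data.Integer as ℤ using (ℤ; +_; -_)
import Data.Integer.Properties as ZP
import Data.Integer.GCD as ZG
open import Data.Integer.Tactic.RingSolver using (solve-∀)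
open import Data.Rational as ℚ using (ℚ; ↥_; ↧_; 0ℚ)
import Data.Rational.Properties as QP
open import Data.Product using (Σ; _,_; proj₁; proj₂)
open import Relation.Binary.PropositionalEquality hiding (preorder)
open import Data.List as List using (List; []; _∷_; _++_; map; length; filterᵇ; replicate)
import Data.List.Properties as LP
open import Data.List.Properties using (∷-injective)
open import Data.List.Membership.Propositional using (_∈_)
open import Data.List.Membership.Propositional.Properties using (∈-++⁻; ∈-map⁻; ∈-map⁺; ∈-++⁺ˡ; ∈-++⁺ʳ)
open import Data.List.Relation.Unary.Any using (here; there)
open import Data.List.Relation.Unary.All as All using (All)
import Data.List.Relation.Unary.All.Properties as AllP
open import Data.List.Relation.Unary.AllPairs as AllPairs using (AllPairs)
open import Data.List.Relation.Unary.Unique.Propositional using (Unique)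
import Data.List.Relation.Unary.Unique.Propositional.Properties as UP
open import Data.List.Relation.Unary.Linked as Lk using (Linked)
import Data.List.Relation.Unary.Linked.Properties as LkP
open import Data.List.Relation.Binary.Pointwise as PW using (Pointwise; []; _∷_)
open import Data.List.Relation.Binary.Lex.Core using (this; next)
open import Data.List.Relation.Binary.Lex.Strict using (Lex-<)
open import Data.Vec using (Vec; []; _∷_)
open import Data.Maybe using (just)
open import Data.Empty using (⊥; ⊥-elim)
open import Data.Unit using (⊤; tt)
open import Data.Bool using (Bool; true; false; not; T)
open import Data.Bool.Properties using (T-∧; T-∨)
open import Function using (_∘_; case_of_; Equivalence)
open import Relation.Nullary.Decidable using (T?)
open import Relation.Binary.Definitions using (tri<; tri≈; tri>)
open import Data.Sum as Sum using (_⊎_; inj₁; inj₂)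
open import Relation.Nullary using (¬_; yes; no)

++-assoc₃ : ∀ {A : Set} (a b c d : List A) → (a ++ b ++ c) ++ d ≡ a ++ b ++ (c ++ d)
++-assoc₃ a b c d = trans (LP.++-assoc a (b ++ c) d) (cong (a ++_) (LP.++-assoc b c d))

Unique-split : ∀ {A : Set} (l₁ l₂ r₁ r₂ : List A) x → Unique (l₁ ++ x ∷ r₁) →
               l₁ ++ x ∷ r₁ ≡ l₂ ++ x ∷ r₂ → l₁ ≡ l₂ × r₁ ≡ r₂
Unique-split [] [] r₁ r₂ x _ eq = refl , LP.∷-injectiveʳ eq
Unique-split [] (y ∷ l₂) r₁ r₂ x (x∉ AllPairs.∷ _) eq with refl , eq' ← ∷-injective eq =
  ⊥-elim (All.lookup x∉ (subst (x ∈_) (sym eq') (∈-++⁺ʳ l₂ (here refl))) refl)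
Unique-split (y ∷ l₁) [] r₁ r₂ x (y∉ AllPairs.∷ _) eq with refl , _ ← ∷-injective eq =
  ⊥-elim (All.lookup y∉ (∈-++⁺ʳ l₁ (here refl)) refl)
Unique-split (y ∷ l₁) (z ∷ l₂) r₁ r₂ x (_ AllPairs.∷ u) eq
  with refl , eq' ← ∷-injective eq
  with refl , r₁≡r₂ ← Unique-split l₁ l₂ r₁ r₂ x u eq' = refl , r₁≡r₂

++-split-by-length : ∀ {A : Set} (a a' r r' : List A) → length a ≡ length a' → a ++ r ≡ a' ++ r' → a ≡ a' × r ≡ r'
++-split-by-length [] [] r r' _ eq = refl , eq
++-split-by-length (x ∷ a) (y ∷ a') r r' len eq
  with refl , eq' ← ∷-injective eq
  with refl , r≡r' ← ++-split-by-length a a' r r' (NP.suc-injective len) eq' = refl , r≡r'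

split-at-pair : ∀ {A : Set} (l : List A) n m → length l ≡ n + suc (suc m) →
  Σ (List A) λ xs → Σ A λ p → Σ A λ q → Σ (List A) λ ys → l ≡ xs ++ p ∷ q ∷ ys × length xs ≡ n
split-at-pair [] n m eq with () ← trans eq (NP.+-suc n (suc m))
split-at-pair (x ∷ []) zero m ()
split-at-pair (p ∷ q ∷ ys) zero m eq = [] , p , q , ys , refl , refl
split-at-pair (x ∷ l) (suc n) m eq with xs , p , q , ys , refl , refl ← split-at-pair l n m (NP.suc-injective eq) =
  x ∷ xs , p , q , ys , refl , refl

¬T⇒T-not : ∀ {b} → ¬ T b → T (not b)
¬T⇒T-not {false} _ = tt
¬T⇒T-not {true} ¬T = ¬T tt

T⇒¬T-not : ∀ {b} → T b → ¬ T (not b)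
T⇒¬T-not {true} _ ()

filterᵇ-first-accepted : ∀ {A : Set} (p : A → Bool) xs y ys → All (λ x → ¬ T (p x)) xs → T (p y) →
                         filterᵇ p (xs ++ y ∷ ys) ≡ y ∷ filterᵇ p ys
filterᵇ-first-accepted p [] y ys _ py = LP.filter-accept (T? ∘ p) py
filterᵇ-first-accepted p (x ∷ xs) y ys (¬px All.∷ rejected) py =
  trans (LP.filter-reject (T? ∘ p) ¬px) (filterᵇ-first-accepted p xs y ys rejected py)

drop⇒∈ : ∀ {A : Set} k (σ : List A) {z τ} → List.drop k σ ≡ z ∷ τ → z ∈ σ
drop⇒∈ zero (x ∷ σ) refl = here refl
drop⇒∈ (suc k) (x ∷ σ) eq = there (drop⇒∈ k σ eq)

drop-pred : ∀ {A : Set} k (σ : List A) {z τ} → List.drop (suc k) σ ≡ z ∷ τ → Σ A λ y → List.drop k σ ≡ y ∷ z ∷ τ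
drop-pred zero (y ∷ σ) eq = y , cong (y ∷_) eq
drop-pred (suc k) (y ∷ σ) eq = drop-pred k σ eq

-- Slots and their connection values

toℚ : ℕ → ℚ
toℚ m = (+ m) ℚ./ 1

½^ : ℕ → ℚ
½^ k = ℚ._/_ (+ 1) (2 ^ k) {{NP.m^n≢0 2 k}}

/-reduced : ∀ i n .{{_ : ℕ.NonZero n}} → ZG.gcd i (+ n) ≡ + 1 → ↥ (i ℚ./ n) ≡ i × ↧ (i ℚ./ n) ≡ + n
/-reduced i n g = trans (sym (ZP.*-identityʳ _)) (trans (cong (↥ (i ℚ./ n) ℤ.*_) (sym g)) (QP.↥-/ i n)) ,
                  trans (sym (ZP.*-identityʳ _)) (trans (cong (↧ (i ℚ./ n) ℤ.*_) (sym g)) (QP.↧-/ i n))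

toℚ-parts : ∀ m → ↥ toℚ m ≡ + m × ↧ toℚ m ≡ + 1
toℚ-parts m = /-reduced (+ m) 1 (cong +_ (GCD.gcd-zeroʳ m))

½^-parts : ∀ k → ↥ ½^ k ≡ + 1 × ↧ ½^ k ≡ + (2 ^ k)
½^-parts k = /-reduced (+ 1) (2 ^ k) {{NP.m^n≢0 2 k}} (cong +_ (GCD.gcd-zeroˡ (2 ^ k)))

<-by-parts : ∀ (x y : ℚ) {a b c d} → ↥ x ≡ a → ↧ y ≡ b → ↥ y ≡ c → ↧ x ≡ d → a ℤ.* b ℤ.< c ℤ.* d → x ℚ.< y
<-by-parts x y refl refl refl refl h = ℚ.*<* h

≤-by-parts : ∀ (x y : ℚ) {a b c d} → ↥ x ≡ a → ↧ y ≡ b → ↥ y ≡ c → ↧ x ≡ d → a ℤ.* b ℤ.≤ c ℤ.* d → x ℚ.≤ y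
≤-by-parts x y refl refl refl refl h = ℚ.*≤* h

½^-pos : ∀ k → 0ℚ ℚ.< ½^ k
½^-pos k = <-by-parts 0ℚ (½^ k) refl (proj₂ (½^-parts k)) (proj₁ (½^-parts k)) refl (ℤ.+<+ (s≤s z≤n))

½^-antitone : ∀ {k k'} → k < k' → ½^ k' ℚ.< ½^ k
½^-antitone {k} {k'} k<k' =
  <-by-parts (½^ k') (½^ k) (proj₁ (½^-parts k')) (proj₂ (½^-parts k)) (proj₁ (½^-parts k)) (proj₂ (½^-parts k'))
    (subst₂ ℤ._<_ (sym (ZP.*-identityˡ _)) (sym (ZP.*-identityˡ _)) (ℤ.+<+ (NP.^-monoʳ-< 2 (s≤s (s≤s z≤n)) k<k')))

toℚ-mono-≤ : ∀ {m n} → m ≤ n → toℚ m ℚ.≤ toℚ n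
toℚ-mono-≤ {m} {n} m≤n =
  ≤-by-parts (toℚ m) (toℚ n) (proj₁ (toℚ-parts m)) (proj₂ (toℚ-parts n)) (proj₁ (toℚ-parts n)) (proj₂ (toℚ-parts m))
    (subst₂ ℤ._≤_ (sym (ZP.*-identityʳ _)) (sym (ZP.*-identityʳ _)) (ℤ.+≤+ m≤n))

-- ↥ and ↧ of a sum are only known up to the common factor g removed by normalisation.
≤-by-scaled-parts : ∀ (x y : ℚ) {N D g : ℤ} → ℤ.0ℤ ℤ.< D → ↥ x ℤ.* g ≡ N → ↧ x ℤ.* g ≡ D →
                    N ℤ.* ↧ y ℤ.≤ ↥ y ℤ.* D → x ℚ.≤ y
≤-by-scaled-parts x y {N} {D} {g} D>0 refl refl h =
  ℚ.*≤* (ZP.*-cancelʳ-≤-pos (↥ x ℤ.* ↧ y) (↥ y ℤ.* ↧ x) D {{ℤ.positive D>0}}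
           (subst₂ ℤ._≤_ (reassoc₁ (↥ x) (↧ x) (↧ y) g) (reassoc₂ (↥ y) (↧ x) g) (ZP.*-monoʳ-≤-nonNeg (↧ x) h)))
  where
    reassoc₁ : ∀ a b c e → ((a ℤ.* e) ℤ.* c) ℤ.* b ≡ (a ℤ.* c) ℤ.* (b ℤ.* e)
    reassoc₁ = solve-∀
    reassoc₂ : ∀ a b e → (a ℤ.* (b ℤ.* e)) ℤ.* b ≡ (a ℤ.* b) ℤ.* (b ℤ.* e)
    reassoc₂ = solve-∀

toℚ+½^≤toℚ-suc : ∀ p k → toℚ p ℚ.+ ½^ k ℚ.≤ toℚ (p + 1)
toℚ+½^≤toℚ-suc p k =
  ≤-by-scaled-parts (toℚ p ℚ.+ ½^ k) (toℚ (p + 1)) (denominator>0 (toℚ-parts p) (½^-parts k))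
    (QP.↥-+ (toℚ p) (½^ k)) (QP.↧-+ (toℚ p) (½^ k)) (cross (toℚ-parts p) (½^-parts k) (toℚ-parts (p + 1)))
  where
    denominator>0 : ∀ {a b c d} → a ≡ + p × d ≡ + 1 → c ≡ + 1 × b ≡ + (2 ^ k) → ℤ.0ℤ ℤ.< d ℤ.* b
    denominator>0 (_ , refl) (_ , refl) = subst (ℤ.0ℤ ℤ.<_) (sym (ZP.*-identityˡ _)) (ℤ.+<+ (NP.m^n>0 2 k))
    cross : ∀ {a b c d e f} → a ≡ + p × d ≡ + 1 → c ≡ + 1 × b ≡ + (2 ^ k) → f ≡ + (p + 1) × e ≡ + 1 →
            (a ℤ.* b ℤ.+ c ℤ.* d) ℤ.* e ℤ.≤ f ℤ.* (d ℤ.* b)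
    cross (refl , refl) (refl , refl) (refl , refl) rewrite ZP.pos-+ p 1 =
      subst₂ ℤ._≤_ (lhs (+ p) (+ (2 ^ k))) (rhs (+ p) (+ (2 ^ k)))
        (ZP.+-monoʳ-≤ (+ p ℤ.* + (2 ^ k)) (ℤ.+≤+ (NP.m^n>0 2 k)))
      where
        lhs : ∀ P h → P ℤ.* h ℤ.+ ℤ.1ℤ ≡ (P ℤ.* h ℤ.+ ℤ.1ℤ ℤ.* ℤ.1ℤ) ℤ.* ℤ.1ℤ
        lhs = solve-∀
        rhs : ∀ P h → P ℤ.* h ℤ.+ h ≡ (P ℤ.+ ℤ.1ℤ) ℤ.* (ℤ.1ℤ ℤ.* h)
        rhs = solve-∀

toℚ-½^<toℚ : ∀ m k → toℚ m ℚ.- ½^ k ℚ.< toℚ m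
toℚ-½^<toℚ m k =
  subst (toℚ m ℚ.- ½^ k ℚ.<_) (QP.+-identityʳ (toℚ m)) (QP.+-monoʳ-< (toℚ m) (QP.neg-antimono-< (½^-pos k)))

toℚ≤toℚ-suc-½^ : ∀ p k → toℚ p ℚ.≤ toℚ (p + 1) ℚ.- ½^ k
toℚ≤toℚ-suc-½^ p k = subst (ℚ._≤ toℚ (p + 1) ℚ.- ½^ k) [p+h]-h≡p (QP.+-monoˡ-≤ (ℚ.- ½^ k) (toℚ+½^≤toℚ-suc p k))
  where
    [p+h]-h≡p : (toℚ p ℚ.+ ½^ k) ℚ.- ½^ k ≡ toℚ p
    [p+h]-h≡p = trans (QP.+-assoc (toℚ p) (½^ k) (ℚ.- ½^ k))
                  (trans (cong (toℚ p ℚ.+_) (QP.+-inverseʳ (½^ k))) (QP.+-identityʳ (toℚ p)))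

-- A slot (p , j , a) is the j-th child position of node p, whose decoration has arity a.
Slot : Set
Slot = ℕ × ℕ × ℕ

slotCnc : Slot → ℚ
slotCnc (p , j , a) = toℚ (p + 1) ℚ.- ½^ (a ∸ j)

-- x ⊐ y: x lies above y on the stack of pending child slots of a preorder traversal.
_⊐_ : Slot → Slot → Set
(p , j , a) ⊐ (p' , j' , a') = p' < p ⊎ (p ≡ p' × a ≡ a' × j < j' × j' ≤ a')

⊐-irrefl : ∀ {s} → ¬ (s ⊐ s)
⊐-irrefl (inj₁ lt) = NP.<-irrefl refl lt
⊐-irrefl (inj₂ (_ , _ , lt , _)) = NP.<-irrefl refl lt

⊐-trans : ∀ {x y z} → x ⊐ y → y ⊐ z → x ⊐ z
⊐-trans (inj₁ y<x) (inj₁ z<y) = inj₁ (NP.<-trans z<y y<x)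
⊐-trans (inj₁ y<x) (inj₂ (refl , _)) = inj₁ y<x
⊐-trans (inj₂ (refl , _)) (inj₁ z<y) = inj₁ z<y
⊐-trans (inj₂ (refl , refl , j<j' , _)) (inj₂ (refl , refl , j'<j'' , j''≤a)) = inj₂ (refl , refl , NP.<-trans j<j' j'<j'' , j''≤a)

⊐⇒cnc> : ∀ {x y} → x ⊐ y → slotCnc y ℚ.< slotCnc x
⊐⇒cnc> {p , j , a} {p' , j' , a'} (inj₁ p'<p) =
  QP.<-≤-trans (toℚ-½^<toℚ (p' + 1) (a' ∸ j'))
    (QP.≤-trans (toℚ-mono-≤ (subst (_≤ p) (NP.+-comm 1 p') p'<p)) (toℚ≤toℚ-suc-½^ p (a ∸ j)))
⊐⇒cnc> {p , j , a} {.p , j' , .a} (inj₂ (refl , refl , j<j' , j'≤a)) =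
  QP.+-monoʳ-< (toℚ (p + 1)) (QP.neg-antimono-< (½^-antitone (NP.∸-monoʳ-< j<j' j'≤a)))

module _ {Sig : Signature} where

  -- Terms as preorder words

  Info : Set
  Info = NodeInfo {Sig}

  Tm : Set
  Tm = Term Sig

  -- A term is determined by its preorder word: ○ for a leaf, ● s for a node decorated by s.
  data Token : Set where
    ○ : Token
    ● : S Sig → Token

  mutual
    tokens : Tm → List Token
    tokens leaf = ○ ∷ []
    tokens (node s ts) = ● s ∷ tokens* ts

    tokens* : ∀ {k} → Vec Tm k → List Token
    tokens* [] = []
    tokens* (t ∷ ts) = tokens t ++ tokens* ts

  ●-injective : ∀ {s s'} → ● s ≡ ● s' → s ≡ s'
  ●-injective refl = refl

  mutual
    tokens-++-injective : ∀ t t' r r' → tokens t ++ r ≡ tokens t' ++ r' → t ≡ t' × r ≡ r'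
    tokens-++-injective leaf leaf r r' eq = refl , LP.∷-injectiveʳ eq
    tokens-++-injective leaf (node s ts) r r' ()
    tokens-++-injective (node s ts) leaf r r' ()
    tokens-++-injective (node s ts) (node s' ts') r r' eq
      with refl ← ●-injective (LP.∷-injectiveˡ eq)
      with refl , r≡r' ← tokens*-++-injective ts ts' r r' (LP.∷-injectiveʳ eq)
      = refl , r≡r'

    tokens*-++-injective : ∀ {k} (ts ts' : Vec Tm k) r r' → tokens* ts ++ r ≡ tokens* ts' ++ r' → ts ≡ ts' × r ≡ r'
    tokens*-++-injective [] [] r r' eq = refl , eq
    tokens*-++-injective (t ∷ ts) (t' ∷ ts') r r' eq
      with refl , rest ← tokens-++-injective t t' (tokens* ts ++ r) (tokens* ts' ++ r')
                           (trans (sym (LP.++-assoc (tokens t) _ r)) (trans eq (LP.++-assoc (tokens t') _ r')))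
      with refl , r≡r' ← tokens*-++-injective ts ts' r r' rest
      = refl , r≡r'

  tokens-injective : ∀ t t' → tokens t ≡ tokens t' → t ≡ t'
  tokens-injective t t' eq =
    proj₁ (tokens-++-injective t t' [] [] (trans (LP.++-identityʳ _) (trans eq (sym (LP.++-identityʳ _)))))

  #nodes : List Token → ℕ
  #nodes [] = 0
  #nodes (○ ∷ w) = #nodes w
  #nodes (● _ ∷ w) = suc (#nodes w)

  #nodes-++ : ∀ a b → #nodes (a ++ b) ≡ #nodes a + #nodes b
  #nodes-++ [] b = refl
  #nodes-++ (○ ∷ a) b = #nodes-++ a b
  #nodes-++ (● _ ∷ a) b = cong suc (#nodes-++ a b)

  #nodes-○ : ∀ b ba → #nodes (b ++ ○ ∷ ba) ≡ #nodes (b ++ ba)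
  #nodes-○ b ba = trans (#nodes-++ b (○ ∷ ba)) (sym (#nodes-++ b ba))

  -- Annotating a preorder word

  infoAt : S Sig → Slot → ℕ → Info
  infoAt s (p , j , a) n = nodeInfo s p j a n

  slotOf : Info → Slot
  slotOf e = (pa e , lp e , par e)

  infoCnc : Info → ℚ
  infoCnc e = slotCnc (slotOf e)

  top : List Slot → Slot
  top [] = (0 , 0 , 0)
  top (x ∷ _) = x

  pop : List Slot → List Slot
  pop [] = []
  pop (_ ∷ σ) = σ

  childSlots : ℕ → ℕ → ℕ → ℕ → List Slot
  childSlots p a j zero = []
  childSlots p a j (suc k) = (p , j , a) ∷ childSlots p a (suc j) k

  childSlotsOf : ℕ → ℕ → List Slot
  childSlotsOf n a = childSlots n a 1 a

  -- Reading a preorder word with the next free index n and the stack σ of pending child slots: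
  -- a node takes its parent edge from the top slot and pushes the slots of its own children,
  -- a leaf just consumes the top slot. (top of an empty stack is junk, excluded by NoUnderflow.)
  State : Set
  State = ℕ × List Slot

  annotate : State → List Token → List Info
  annotate (n , σ) [] = []
  annotate (n , σ) (○ ∷ w) = annotate (n , pop σ) w
  annotate (n , σ) (● s ∷ w) = infoAt s (top σ) n ∷ annotate (suc n , childSlotsOf n (arity Sig s) ++ pop σ) w

  run : State → List Token → State
  run (n , σ) [] = (n , σ)
  run (n , σ) (○ ∷ w) = run (n , pop σ) w
  run (n , σ) (● s ∷ w) = run (suc n , childSlotsOf n (arity Sig s) ++ pop σ) w

  NoUnderflow : State → List Token → Set
  NoUnderflow (n , σ) [] = ⊤
  NoUnderflow (n , []) (_ ∷ _) = ⊥
  NoUnderflow (n , x ∷ σ) (○ ∷ w) = NoUnderflow (n , σ) w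
  NoUnderflow (n , x ∷ σ) (● s ∷ w) = NoUnderflow (suc n , childSlotsOf n (arity Sig s) ++ σ) w

  annotate-++ : ∀ st a b → annotate st (a ++ b) ≡ annotate st a ++ annotate (run st a) b
  annotate-++ st [] b = refl
  annotate-++ (n , σ) (○ ∷ a) b = annotate-++ (n , pop σ) a b
  annotate-++ (n , σ) (● s ∷ a) b = cong (infoAt s (top σ) n ∷_) (annotate-++ _ a b)

  run-++ : ∀ st a b → run st (a ++ b) ≡ run (run st a) b
  run-++ st [] b = refl
  run-++ (n , σ) (○ ∷ a) b = run-++ (n , pop σ) a b
  run-++ (n , σ) (● s ∷ a) b = run-++ _ a b

  NoUnderflow-++⁻ : ∀ st a b → NoUnderflow st (a ++ b) → NoUnderflow st a × NoUnderflow (run st a) b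
  NoUnderflow-++⁻ st [] b ok = tt , ok
  NoUnderflow-++⁻ (n , []) (x ∷ a) b ()
  NoUnderflow-++⁻ (n , y ∷ σ) (○ ∷ a) b ok = NoUnderflow-++⁻ (n , σ) a b ok
  NoUnderflow-++⁻ (n , y ∷ σ) (● s ∷ a) b ok = NoUnderflow-++⁻ _ a b ok

  NoUnderflow-++⁺ : ∀ st a b → NoUnderflow st a → NoUnderflow (run st a) b → NoUnderflow st (a ++ b)
  NoUnderflow-++⁺ st [] b _ ok = ok
  NoUnderflow-++⁺ (n , []) (x ∷ a) b () _
  NoUnderflow-++⁺ (n , y ∷ σ) (○ ∷ a) b ok₁ ok₂ = NoUnderflow-++⁺ (n , σ) a b ok₁ ok₂
  NoUnderflow-++⁺ (n , y ∷ σ) (● s ∷ a) b ok₁ ok₂ = NoUnderflow-++⁺ _ a b ok₁ ok₂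

  record Traces (st : State) (w : List Token) (I : List Info) (st' : State) : Set where
    constructor traces
    field
      annotate≡ : annotate st w ≡ I
      run≡ : run st w ≡ st'
      noUnderflow : NoUnderflow st w

  Traces-++ : ∀ {st w I st' w' I' st''} → Traces st w I st' → Traces st' w' I' st'' → Traces st (w ++ w') (I ++ I') st''
  Traces-++ {st} {w} {w' = w'} (traces refl refl ok) (traces refl refl ok') =
    traces (annotate-++ st w w') (run-++ st w w') (NoUnderflow-++⁺ st w w' ok ok')

  mutual
    infoAux-traces : ∀ t n p j a σ → Traces (n , (p , j , a) ∷ σ) (tokens t) (infoAux p j a n t) (n + deg t , σ)
    infoAux-traces leaf n p j a σ = traces refl (cong (_, σ) (sym (NP.+-identityʳ n))) tt
    infoAux-traces (node s ts) n p j a σ with traces ann≡ run≡ ok ← infoAuxs-traces ts (suc n) n (arity Sig s) 1 σ =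
      traces (cong (nodeInfo s p j a n ∷_) ann≡) (trans run≡ (cong (_, σ) (sym (NP.+-suc n _)))) ok

    infoAuxs-traces : ∀ {k} (ts : Vec Tm k) n p a j σ →
                      Traces (n , childSlots p a j k ++ σ) (tokens* ts) (infoAuxs p a j n ts) (n + degs ts , σ)
    infoAuxs-traces [] n p a j σ = traces refl (cong (_, σ) (sym (NP.+-identityʳ n))) tt
    infoAuxs-traces {suc k} (t ∷ ts) n p a j σ
      with traces ann≡ run≡ ok ← Traces-++ (infoAux-traces t n p j a (childSlots p a (suc j) k ++ σ))
                                           (infoAuxs-traces ts (n + deg t) p a (suc j) σ) =
      traces ann≡ (trans run≡ (cong (_, σ) (NP.+-assoc n (deg t) (degs ts)))) ok

  length-annotate : ∀ n σ w → length (annotate (n , σ) w) ≡ #nodes w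
  length-annotate n σ [] = refl
  length-annotate n σ (○ ∷ w) = length-annotate n (pop σ) w
  length-annotate n σ (● s ∷ w) = cong suc (length-annotate _ _ w)

  StackInv : State → Set
  StackInv (n , σ) = Linked _⊐_ σ × All (λ x → proj₁ x < n) σ

  linked-∷ : ∀ {x σ} → (∀ {y σ'} → σ ≡ y ∷ σ' → x ⊐ y) → Linked _⊐_ σ → Linked _⊐_ (x ∷ σ)
  linked-∷ {σ = []} _ _ = Lk.[-]
  linked-∷ {σ = y ∷ σ} x⊐top linked = x⊐top refl Lk.∷ linked

  childSlots-linked : ∀ n a k j σ → j + k ≤ suc a → Linked _⊐_ σ → All (λ x → proj₁ x < n) σ →
                      Linked _⊐_ (childSlots n a j k ++ σ)
  childSlots-linked n a zero j σ _ linked _ = linked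
  childSlots-linked n a (suc zero) j σ _ linked below = linked-∷ (λ { refl → inj₁ (All.head below) }) linked
  childSlots-linked n a (suc (suc k)) j σ j+k+2≤a+1 linked below =
    inj₂ (refl , refl , NP.n<1+n j , NP.≤-trans (s≤s (NP.m≤m+n j k)) (NP.≤-pred j+k+2≤a+1′))
      Lk.∷ childSlots-linked n a (suc k) (suc j) σ (subst (_≤ suc a) (NP.+-suc j (suc k)) j+k+2≤a+1) linked below
    where
      j+k+2≤a+1′ : suc (suc (j + k)) ≤ suc a
      j+k+2≤a+1′ = subst (_≤ suc a) (trans (NP.+-suc j (suc k)) (cong suc (NP.+-suc j k))) j+k+2≤a+1

  childSlots-parents< : ∀ n a k j σ m → n < m → All (λ x → proj₁ x < m) σ → All (λ x → proj₁ x < m) (childSlots n a j k ++ σ)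
  childSlots-parents< n a zero j σ m _ below = below
  childSlots-parents< n a (suc k) j σ m n<m below = n<m All.∷ childSlots-parents< n a k (suc j) σ m n<m below

  StackInv-push : ∀ n σ a → StackInv (n , σ) → StackInv (suc n , childSlotsOf n a ++ σ)
  StackInv-push n σ a (linked , below) =
    childSlots-linked n a a 1 σ NP.≤-refl linked below ,
    childSlots-parents< n a a 1 σ (suc n) NP.≤-refl (All.map (λ x<n → NP.≤-trans x<n (NP.n≤1+n n)) below)

  StackInv-run : ∀ n σ w → NoUnderflow (n , σ) w → StackInv (n , σ) → StackInv (run (n , σ) w)
  StackInv-run n σ [] _ inv = inv
  StackInv-run n [] (x ∷ w) () _
  StackInv-run n (y ∷ σ) (○ ∷ w) ok (linked , below) = StackInv-run n σ w ok (Lk.tail linked , All.tail below)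
  StackInv-run n (y ∷ σ) (● s ∷ w) ok (linked , below) =
    StackInv-run (suc n) _ w ok (StackInv-push n σ (arity Sig s) (Lk.tail linked , All.tail below))

  linked⇒head-⊐ : ∀ {x xs} → Linked _⊐_ (x ∷ xs) → All (_⊐_ x) xs
  linked⇒head-⊐ linked with head⊐ AllPairs.∷ _ ← LkP.Linked⇒AllPairs ⊐-trans linked = head⊐

  linked⇒top-cnc≥ : ∀ {x σ z} → Linked _⊐_ (x ∷ σ) → z ∈ x ∷ σ → slotCnc z ℚ.≤ slotCnc x
  linked⇒top-cnc≥ linked (here refl) = QP.≤-refl
  linked⇒top-cnc≥ linked (there z∈σ) = QP.<⇒≤ (⊐⇒cnc> (All.lookup (linked⇒head-⊐ linked) z∈σ))

  annotate-idx≥ : ∀ n σ w → All (λ x → n ≤ idx x) (annotate (n , σ) w)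
  annotate-idx≥ n σ [] = All.[]
  annotate-idx≥ n σ (○ ∷ w) = annotate-idx≥ n (pop σ) w
  annotate-idx≥ n σ (● s ∷ w) = NP.≤-refl All.∷ All.map (NP.≤-trans (NP.n≤1+n n)) (annotate-idx≥ (suc n) _ w)

  annotate-idx< : ∀ n σ w → All (λ x → idx x < proj₁ (run (n , σ) w)) (annotate (n , σ) w)
  annotate-idx< n σ [] = All.[]
  annotate-idx< n σ (○ ∷ w) = annotate-idx< n (pop σ) w
  annotate-idx< n σ (● s ∷ w) = run-counter≥ (suc n) _ w All.∷ annotate-idx< (suc n) _ w
    where
      run-counter≥ : ∀ m τ v → m ≤ proj₁ (run (m , τ) v)
      run-counter≥ m τ [] = NP.≤-refl
      run-counter≥ m τ (○ ∷ v) = run-counter≥ m (pop τ) v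
      run-counter≥ m τ (● _ ∷ v) = NP.≤-trans (NP.n≤1+n m) (run-counter≥ (suc m) _ v)

  run-counter : ∀ n σ w → proj₁ (run (n , σ) w) ≡ n + length (annotate (n , σ) w)
  run-counter n σ [] = sym (NP.+-identityʳ n)
  run-counter n σ (○ ∷ w) = run-counter n (pop σ) w
  run-counter n σ (● s ∷ w) = trans (run-counter (suc n) _ w) (sym (NP.+-suc n _))

  rootStack : List Token → List Slot
  rootStack (● s ∷ _) = (1 , 0 , arity Sig s) ∷ []
  rootStack _ = (0 , 0 , 0) ∷ []

  initial : List Token → State
  initial w = (1 , rootStack w)

  initial-∷ : ∀ x w w' → initial (x ∷ w) ≡ initial (x ∷ w')
  initial-∷ ○ w w' = refl
  initial-∷ (● s) w w' = refl

  nodeInfos-traces : ∀ t → Traces (initial (tokens t)) (tokens t) (nodeInfos t) (1 + deg t , [])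
  nodeInfos-traces leaf = traces refl refl tt
  nodeInfos-traces (node s ts) = infoAux-traces (node s ts) 1 1 0 (arity Sig s) []

  -- The stack after reading the root; the "++ []" makes it match what annotate computes definitionally.
  rootChildren : S Sig → List Slot
  rootChildren s = childSlotsOf 1 (arity Sig s) ++ []

  StackInv-rootChildren : ∀ s → StackInv (2 , rootChildren s)
  StackInv-rootChildren s = StackInv-push 1 [] (arity Sig s) (Lk.[] , All.[])

  prefixInfos : List Token → List Info
  prefixInfos bx = annotate (initial bx) bx

  prefixState : List Token → State
  prefixState bx = run (initial bx) bx

  length-prefixInfos : ∀ bx → length (prefixInfos bx) ≡ #nodes bx
  length-prefixInfos bx = length-annotate 1 (rootStack bx) bx

  nodeInfos-prefix : ∀ t x bx w → tokens t ≡ x ∷ bx ++ w →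
                       nodeInfos t ≡ prefixInfos (x ∷ bx) ++ annotate (prefixState (x ∷ bx)) w
                     × NoUnderflow (initial (x ∷ bx)) (x ∷ bx) × NoUnderflow (prefixState (x ∷ bx)) w
  nodeInfos-prefix t x bx w eq
    with traces ann≡ _ ok ← subst (λ v → Traces (initial v) v (nodeInfos t) (1 + deg t , [])) eq (nodeInfos-traces t) =
    trans (sym ann≡) (trans (cong (λ st → annotate st (x ∷ bx ++ w)) root≡) (annotate-++ _ (x ∷ bx) w)) ,
    NoUnderflow-++⁻ _ (x ∷ bx) w (subst (λ st → NoUnderflow st (x ∷ bx ++ w)) root≡ ok)
    where
      root≡ : initial (x ∷ bx ++ w) ≡ initial (x ∷ bx)
      root≡ = initial-∷ x (bx ++ w) bx

  StackInv-prefix : ∀ s₀ bx → NoUnderflow (initial (● s₀ ∷ bx)) (● s₀ ∷ bx) → StackInv (prefixState (● s₀ ∷ bx))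
  StackInv-prefix s₀ bx ok = StackInv-run 2 (rootChildren s₀) bx ok (StackInv-rootChildren s₀)

  annotate-tokens-++ : ∀ u m p j a σ w →
    annotate (m , (p , j , a) ∷ σ) (tokens u ++ w) ≡ infoAux p j a m u ++ annotate (m + deg u , σ) w
  annotate-tokens-++ u m p j a σ w with traces ann≡ run≡ _ ← infoAux-traces u m p j a σ =
    trans (annotate-++ _ (tokens u) w) (cong₂ _++_ ann≡ (cong (λ st → annotate st w) run≡))

  -- Moves as rewrites of preorder words

  mutual
    length-preorder : ∀ t → length (preorder t) ≡ length (tokens t)
    length-preorder leaf = refl
    length-preorder (node s ts) = cong suc (length-preorders 0 ts)

    length-preorders : ∀ {k} m (ts : Vec Tm k) → length (preorders m ts) ≡ length (tokens* ts)
    length-preorders m [] = refl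
    length-preorders m (t ∷ ts) = trans (LP.length-++ (map (m ∷_) (preorder t)))
      (trans (cong₂ _+_ (trans (LP.length-map (m ∷_) (preorder t)) (length-preorder t)) (length-preorders (suc m) ts))
             (sym (LP.length-++ (tokens t))))

  mutual
    replaceAt-subAt : ∀ t p v → subAt t p ≡ just v → replaceAt t p v ≡ t
    replaceAt-subAt t [] v refl = refl
    replaceAt-subAt leaf (k ∷ p) v ()
    replaceAt-subAt (node s ts) (k ∷ p) v h = cong (node s) (replaceAts-subAts ts k p v h)

    replaceAts-subAts : ∀ {m} (ts : Vec Tm m) k p v → subAts ts k p ≡ just v → replaceAts ts k p v ≡ ts
    replaceAts-subAts [] k p v ()
    replaceAts-subAts (t ∷ ts) zero p v h = cong (Data.Vec._∷ ts) (replaceAt-subAt t p v h)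
    replaceAts-subAts (t ∷ ts) (suc k) p v h = cong (t Data.Vec.∷_) (replaceAts-subAts ts k p v h)

  record Context (pre : Tm → List (List ℕ)) (tok : Tm → List Token) (p : List ℕ) : Set where
    constructor context
    field
      addrsBefore addrsAfter : List (List ℕ)
      tokensBefore tokensAfter : List Token
      length-before : length addrsBefore ≡ length tokensBefore
      preorder≡ : ∀ w → pre w ≡ addrsBefore ++ map (p ++_) (preorder w) ++ addrsAfter
      tokens≡ : ∀ w → tok w ≡ tokensBefore ++ tokens w ++ tokensAfter

  mutual
    contextAt : ∀ t p v → subAt t p ≡ just v → Context (λ w → preorder (replaceAt t p w)) (λ w → tokens (replaceAt t p w)) p
    contextAt t [] v h = context [] [] [] [] refl (λ w → sym (trans (LP.++-identityʳ _) (LP.map-id (preorder w))))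
                                 (λ w → sym (LP.++-identityʳ _))
    contextAt leaf (k ∷ p) v ()
    contextAt (node s ts) (k ∷ p) v h with context B A bB bA len pre tok ← contextAts ts 0 k p v h =
      context ([] ∷ B) A (● s ∷ bB) bA (cong suc len) (λ w → cong ([] ∷_) (pre w)) (λ w → cong (● s ∷_) (tok w))

    contextAts : ∀ {n} (ts : Vec Tm n) m k p v → subAts ts k p ≡ just v →
      Context (λ w → preorders m (replaceAts ts k p w)) (λ w → tokens* (replaceAts ts k p w)) ((m + k) ∷ p)
    contextAts [] m k p v ()
    contextAts (t ∷ ts) m zero p v h rewrite NP.+-identityʳ m with context B A bB bA len pre tok ← contextAt t p v h =
      context (map (m ∷_) B) (map (m ∷_) A ++ preorders (suc m) ts) bB (bA ++ tokens* ts)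
        (trans (LP.length-map (m ∷_) B) len)
        (λ w → trans (cong (λ z → map (m ∷_) z ++ preorders (suc m) ts) (pre w)) (map-∷-++ B (preorder w) A _))
        (λ w → trans (cong (_++ tokens* ts) (tok w)) (++-assoc₃ bB (tokens w) bA (tokens* ts)))
      where
        map-∷-++ : ∀ (B P A R : List (List ℕ)) →
          map (m ∷_) (B ++ map (p ++_) P ++ A) ++ R ≡ map (m ∷_) B ++ map ((m ∷ p) ++_) P ++ (map (m ∷_) A ++ R)
        map-∷-++ B P A R = begin
            map (m ∷_) (B ++ map (p ++_) P ++ A) ++ R
          ≡⟨ cong (_++ R) (LP.map-++ (m ∷_) B (map (p ++_) P ++ A)) ⟩
            (map (m ∷_) B ++ map (m ∷_) (map (p ++_) P ++ A)) ++ R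
          ≡⟨ cong (λ z → (map (m ∷_) B ++ z) ++ R) (LP.map-++ (m ∷_) (map (p ++_) P) A) ⟩
            (map (m ∷_) B ++ (map (m ∷_) (map (p ++_) P) ++ map (m ∷_) A)) ++ R
          ≡⟨ cong (λ z → (map (m ∷_) B ++ (z ++ map (m ∷_) A)) ++ R) (sym (LP.map-∘ P)) ⟩
            (map (m ∷_) B ++ (map ((m ∷ p) ++_) P ++ map (m ∷_) A)) ++ R
          ≡⟨ ++-assoc₃ (map (m ∷_) B) (map ((m ∷ p) ++_) P) (map (m ∷_) A) R ⟩
            map (m ∷_) B ++ map ((m ∷ p) ++_) P ++ (map (m ∷_) A ++ R)
          ∎
          where open ≡-Reasoning
    contextAts (t ∷ ts) m (suc k) p v h rewrite NP.+-suc m k with context B A bB bA len pre tok ← contextAts ts (suc m) k p v h =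
      context (map (m ∷_) (preorder t) ++ B) A (tokens t ++ bB) bA
        (trans (LP.length-++ (map (m ∷_) (preorder t)))
          (trans (cong₂ _+_ (trans (LP.length-map (m ∷_) (preorder t)) (length-preorder t)) len) (sym (LP.length-++ (tokens t)))))
        (λ w → trans (cong (map (m ∷_) (preorder t) ++_) (pre w)) (sym (LP.++-assoc (map (m ∷_) (preorder t)) B _)))
        (λ w → trans (cong (tokens t ++_) (tok w)) (sym (LP.++-assoc (tokens t) bB _)))

  mutual
    ∈-preorder⇒subAt : ∀ t p → p ∈ preorder t → Σ Tm λ v → subAt t p ≡ just v
    ∈-preorder⇒subAt leaf p (here refl) = leaf , refl
    ∈-preorder⇒subAt (node s ts) p (here refl) = node s ts , refl
    ∈-preorder⇒subAt (node s ts) p (there p∈) with k , p' , v , refl , hv ← ∈-preorders⇒subAts 0 ts p p∈ = v , hv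

    ∈-preorders⇒subAts : ∀ {n} m (ts : Vec Tm n) p → p ∈ preorders m ts →
      Σ ℕ λ k → Σ (List ℕ) λ p' → Σ Tm λ v → p ≡ (m + k) ∷ p' × subAts ts k p' ≡ just v
    ∈-preorders⇒subAts m (t ∷ ts) p p∈ with ∈-++⁻ (map (m ∷_) (preorder t)) p∈
    ... | inj₁ p∈t with p' , p'∈ , refl ← ∈-map⁻ (m ∷_) p∈t with v , hv ← ∈-preorder⇒subAt t p' p'∈ =
      0 , p' , v , cong (_∷ p') (sym (NP.+-identityʳ m)) , hv
    ... | inj₂ p∈ts with k , p' , v , refl , hv ← ∈-preorders⇒subAts (suc m) ts p p∈ts =
      suc k , p' , v , cong (_∷ p') (sym (NP.+-suc m k)) , hv

  mutual
    preorder-unique : ∀ t → Unique (preorder t)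
    preorder-unique leaf = All.[] AllPairs.∷ AllPairs.[]
    preorder-unique (node s ts) = All.tabulate root∉ AllPairs.∷ preorders-unique 0 ts
      where
        root∉ : ∀ {p} → p ∈ preorders 0 ts → [] ≢ p
        root∉ p∈ with k , p' , v , refl , _ ← ∈-preorders⇒subAts 0 ts _ p∈ = λ ()

    preorders-unique : ∀ {n} m (ts : Vec Tm n) → Unique (preorders m ts)
    preorders-unique m [] = AllPairs.[]
    preorders-unique m (t ∷ ts) = UP.++⁺ (UP.map⁺ LP.∷-injectiveʳ (preorder-unique t)) (preorders-unique (suc m) ts) disjoint
      where
        disjoint : ∀ {p} → ¬ (p ∈ map (m ∷_) (preorder t) × p ∈ preorders (suc m) ts)
        disjoint (p∈t , p∈ts) with p' , _ , refl ← ∈-map⁻ (m ∷_) p∈t with k , _ , _ , eq , _ ← ∈-preorders⇒subAts (suc m) ts _ p∈ts =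
          NP.<-irrefl (LP.∷-injectiveˡ eq) (s≤s (NP.m≤m+n m k))

  -- Locating the address p at position length xs of the preorder also locates its subterm in the word.
  record Located (t : Tm) (xs : List (List ℕ)) (p : List ℕ) : Set where
    constructor located
    field
      tokensBefore tokensAfter : List Token
      addrsAfter : List (List ℕ)
      length-before : length tokensBefore ≡ length xs
      preorder≡ : ∀ w → preorder (replaceAt t p w) ≡ xs ++ map (p ++_) (preorder w) ++ addrsAfter
      tokens≡ : ∀ w → tokens (replaceAt t p w) ≡ tokensBefore ++ tokens w ++ tokensAfter

  preorder-tail : Tm → List (List ℕ)
  preorder-tail leaf = []
  preorder-tail (node _ ts) = preorders 0 ts

  map-++-preorder : ∀ p (A : List (List ℕ)) w → map (p ++_) (preorder w) ++ A ≡ p ∷ map (p ++_) (preorder-tail w) ++ A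
  map-++-preorder p A leaf = cong (λ q → q ∷ A) (LP.++-identityʳ p)
  map-++-preorder p A (node _ ts) = cong (λ q → q ∷ map (p ++_) (preorders 0 ts) ++ A) (LP.++-identityʳ p)

  locate : ∀ t xs p ys {v} → preorder t ≡ xs ++ p ∷ ys → subAt t p ≡ just v → Located t xs p
  locate t xs p ys {v} pre hv
    with context B A bB bA len preorder≡ tokens≡ ← contextAt t p v hv
    with refl , _ ← Unique-split xs B ys (map (p ++_) (preorder-tail v) ++ A) p (subst Unique pre (preorder-unique t))
                      (trans (sym pre) (trans (cong preorder (sym (replaceAt-subAt t p v hv)))
                        (trans (preorder≡ v) (cong (B ++_) (map-++-preorder p A v)))))
    = located bB bA A (sym len) preorder≡ tokens≡

  Located-tokens : ∀ {t xs p v} (L : Located t xs p) → subAt t p ≡ just v →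
                   tokens t ≡ Located.tokensBefore L ++ tokens v ++ Located.tokensAfter L
  Located-tokens {t} {p = p} {v} L hv = trans (cong tokens (sym (replaceAt-subAt t p v hv))) (Located.tokens≡ L v)

  record MoveShape (t t₂ : Tm) : Set where
    constructor moveShape
    field
      before : List Token
      movedDec : S Sig
      movedChildren : Vec Tm (arity Sig movedDec)
      after : List Token
      tokens-source : tokens t ≡ before ++ ○ ∷ tokens (node movedDec movedChildren) ++ after
      tokens-target : tokens t₂ ≡ before ++ tokens (node movedDec movedChildren) ++ ○ ∷ after

  leaf-first : ∀ v r r' → tokens v ++ r ≡ ○ ∷ r' → v ≡ leaf × r ≡ r'
  leaf-first leaf r r' eq = refl , LP.∷-injectiveʳ eq
  leaf-first (node _ _) r r' ()

  graft-at-leaf : ∀ t xs p ys bB bA → preorder t ≡ xs ++ p ∷ ys → tokens t ≡ bB ++ ○ ∷ bA → length bB ≡ length xs →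
                  ∀ w → tokens (replaceAt t p w) ≡ bB ++ tokens w ++ bA
  graft-at-leaf t xs p ys bB bA pre tok len
    with v , hv ← ∈-preorder⇒subAt t p (subst (p ∈_) (sym pre) (∈-++⁺ʳ xs (here refl)))
    with L@(located bB' bA' _ len' _ tok') ← locate t xs p ys pre hv
    with refl , v-rest ← ++-split-by-length bB' bB (tokens v ++ bA') (○ ∷ bA) (trans len' (sym len)) (trans (sym (Located-tokens L hv)) tok)
    with refl , refl ← leaf-first v bA' bA v-rest
    = tok'

  moveShape-at : ∀ t p q xs ys u → preorder t ≡ xs ++ p ∷ q ∷ ys → subAt t p ≡ just leaf → subAt t q ≡ just u → IsNode u →
    Σ (MoveShape t (replaceAt (replaceAt t q leaf) p u)) λ m → length (MoveShape.before m) ≡ length xs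
  moveShape-at t p q xs ys _ pre hp hq (s , us , refl)
    with Lp@(located bB bAp _ lenp _ _) ← locate t xs p (q ∷ ys) pre hp
       | Lq@(located bBq bA Aq lenq preq tokq) ← locate t (xs ++ p ∷ []) q ys (trans pre (sym (LP.++-assoc xs (p ∷ []) (q ∷ ys)))) hq
    with refl , refl ← ++-split-by-length (bB ++ ○ ∷ []) bBq bAp (tokens (node s us) ++ bA)
                      (trans (LP.length-++ bB) (trans (cong (_+ 1) lenp) (trans (sym (LP.length-++ xs)) (sym lenq))))
                      (trans (LP.++-assoc bB (○ ∷ []) bAp) (trans (sym (Located-tokens Lp hp)) (Located-tokens Lq hq)))
    = moveShape bB s us bA (Located-tokens Lp hp)
        (graft-at-leaf (replaceAt t q leaf) xs p (q ∷ Aq) bB (○ ∷ bA)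
          (trans (preq leaf) (trans (cong (λ z → (xs ++ p ∷ []) ++ z ∷ Aq) (LP.++-identityʳ q)) (LP.++-assoc xs (p ∷ []) (q ∷ Aq))))
          (trans (tokq leaf) (LP.++-assoc bB (○ ∷ []) (○ ∷ bA))) lenp (node s us)) ,
      lenp

  shapeOfMove : ∀ {t t₂} → t ⟶ t₂ → MoveShape t t₂
  shapeOfMove {t} (p , q , xs , ys , u , pre , hp , hq , isn , refl) = proj₁ (moveShape-at t p q xs ys u pre hp hq isn)

  move-from-tokens : ∀ t bx s r → tokens t ≡ bx ++ ○ ∷ ● s ∷ r →
                     Σ Tm λ t₂ → (t ⟶ t₂) × Σ (MoveShape t t₂) λ m → MoveShape.before m ≡ bx
  move-from-tokens t bx s r eq
    with xs , p , q , ys , pre , lenxs ← split-at-pair (preorder t) (length bx) (length r)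
                                          (trans (length-preorder t) (trans (cong length eq) (LP.length-++ bx)))
    with v , hv ← ∈-preorder⇒subAt t p (subst (p ∈_) (sym pre) (∈-++⁺ʳ xs (here refl)))
       | v' , hv' ← ∈-preorder⇒subAt t q (subst (q ∈_) (sym pre) (∈-++⁺ʳ xs (there (here refl))))
    with Lp@(located bB bA _ lenB _ _) ← locate t xs p (q ∷ ys) pre hv
       | Lq@(located bB' bA' _ lenB' _ _) ← locate t (xs ++ p ∷ []) q ys (trans pre (sym (LP.++-assoc xs (p ∷ []) (q ∷ ys)))) hv'
    with refl , v-rest ← ++-split-by-length bB bx (tokens v ++ bA) (○ ∷ ● s ∷ r) (trans lenB lenxs)
                           (trans (sym (Located-tokens Lp hv)) eq)
       | refl , v'-rest ← ++-split-by-length bB' (bx ++ ○ ∷ []) (tokens v' ++ bA') (● s ∷ r)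
                            (trans lenB' (trans (LP.length-++ xs) (trans (cong (_+ 1) lenxs) (sym (LP.length-++ bx)))))
                            (trans (sym (Located-tokens Lq hv')) (trans eq (sym (LP.++-assoc bx (○ ∷ []) (● s ∷ r)))))
    with refl , _ ← leaf-first v _ _ v-rest
    = node-after v' hv' v'-rest
    where
      node-after : ∀ w {rest} → subAt t q ≡ just w → tokens w ++ rest ≡ ● s ∷ r →
                   Σ Tm λ t₂ → (t ⟶ t₂) × Σ (MoveShape t t₂) λ m → MoveShape.before m ≡ bx
      node-after leaf _ ()
      node-after (node s' us) hw _ with m , lenm ← moveShape-at t p q xs ys (node s' us) pre hv hw (s' , us , refl) =
        _ , (p , q , xs , ys , node s' us , pre , hv , hw , (s' , us , refl) , refl) , m ,
        proj₁ (++-split-by-length (MoveShape.before m) bx _ _ (trans lenm lenxs) (trans (sym (MoveShape.tokens-source m)) eq))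

  move-prefix-unique : ∀ (a a' r r' : List Token) s s' → a ++ ○ ∷ ● s ∷ r ≡ a' ++ ○ ∷ ● s' ∷ r' →
                       #nodes a ≡ #nodes a' → a ≡ a'
  move-prefix-unique [] [] r r' s s' e c = refl
  move-prefix-unique [] (○ ∷ []) r r' s s' () c
  move-prefix-unique [] (○ ∷ ● x ∷ a') r r' s s' e ()
  move-prefix-unique [] (○ ∷ ○ ∷ a') r r' s s' () c
  move-prefix-unique [] (● x ∷ a') r r' s s' () c
  move-prefix-unique (○ ∷ []) [] r r' s s' () c
  move-prefix-unique (○ ∷ ● x ∷ a) [] r r' s s' e ()
  move-prefix-unique (○ ∷ ○ ∷ a) [] r r' s s' () c
  move-prefix-unique (● x ∷ a) [] r r' s s' () c
  move-prefix-unique (○ ∷ a) (○ ∷ a') r r' s s' eq same# = cong (○ ∷_) (move-prefix-unique a a' r r' s s' (LP.∷-injectiveʳ eq) same#)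
  move-prefix-unique (● x ∷ a) (● y ∷ a') r r' s s' eq same# with refl , eq' ← ∷-injective eq =
    cong (● x ∷_) (move-prefix-unique a a' r r' s s' eq' (NP.suc-injective same#))
  move-prefix-unique (○ ∷ a) (● y ∷ a') r r' s s' () c
  move-prefix-unique (● x ∷ a) (○ ∷ a') r r' s s' () c

  inversions : List Token → ℕ
  inversions [] = 0
  inversions (○ ∷ w) = #nodes w + inversions w
  inversions (● _ ∷ w) = inversions w

  inversions-move : ∀ bu ba → inversions (bu ++ ○ ∷ ba) + #nodes bu ≡ #nodes (bu ++ ba) + inversions (bu ++ ba)
  inversions-move [] ba = NP.+-identityʳ _
  inversions-move (○ ∷ b) ba =
    trans (NP.+-assoc (#nodes (b ++ ○ ∷ ba)) (inversions (b ++ ○ ∷ ba)) (#nodes b))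
      (cong₂ _+_ (#nodes-○ b ba) (inversions-move b ba))
  inversions-move (● _ ∷ b) ba = trans (NP.+-suc (inversions (b ++ ○ ∷ ba)) (#nodes b)) (cong suc (inversions-move b ba))

  inversions-prefix : ∀ bx w₁ w₂ → #nodes w₁ ≡ #nodes w₂ → inversions w₁ < inversions w₂ →
                      inversions (bx ++ w₁) < inversions (bx ++ w₂)
  inversions-prefix [] w₁ w₂ _ lt = lt
  inversions-prefix (○ ∷ bx) w₁ w₂ same# lt =
    subst (λ z → z + inversions (bx ++ w₁) < #nodes (bx ++ w₂) + inversions (bx ++ w₂))
      (sym (trans (#nodes-++ bx w₁) (trans (cong (λ k → #nodes bx + k) same#) (sym (#nodes-++ bx w₂)))))
      (NP.+-monoʳ-< (#nodes (bx ++ w₂)) (inversions-prefix bx w₁ w₂ same# lt))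
  inversions-prefix (● _ ∷ bx) w₁ w₂ same# lt = inversions-prefix bx w₁ w₂ same# lt

  move-decreases-inversions : ∀ {x x'} → x ⟶ x' → inversions (tokens x') < inversions (tokens x)
  move-decreases-inversions h with moveShape bx s us ba src tgt ← shapeOfMove h =
    subst₂ _<_ (cong inversions (sym tgt)) (cong inversions (sym src))
      (inversions-prefix bx (bu ++ ○ ∷ ba) (○ ∷ bu ++ ba) (#nodes-○ bu ba)
        (subst (inversions (bu ++ ○ ∷ ba) <_) (inversions-move bu ba)
          (NP.m<m+n (inversions (bu ++ ○ ∷ ba)) (s≤s z≤n))))
    where bu = tokens (node s us)

  -- Moving the node u in front of the leaf that precedes it only changes the slot u is attached to:
  -- with the slots new ∷ old on top of the stack, the leaf used new and u used old; afterwards u uses new.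
  record MoveEffect (t t₂ : Tm) (bx : List Token) : Set where
    constructor moveEffectOf
    field
      m : ℕ
      new old : Slot
      rest : List Slot
      movedDec : S Sig
      after : List Info
      prefixState≡ : prefixState bx ≡ (m , new ∷ old ∷ rest)
      source≡ : nodeInfos t ≡ prefixInfos bx ++ infoAt movedDec old m ∷ after
      target≡ : nodeInfos t₂ ≡ prefixInfos bx ++ infoAt movedDec new m ∷ after
      new⊐old : new ⊐ old
      after-idx> : All (λ e → m < idx e) after

  swapEffect : ∀ {t t₂ bx} s us ba st → prefixState bx ≡ st → StackInv st → NoUnderflow st (○ ∷ tokens (node s us) ++ ba) →
               nodeInfos t ≡ prefixInfos bx ++ annotate st (○ ∷ tokens (node s us) ++ ba) →
               nodeInfos t₂ ≡ prefixInfos bx ++ annotate st (tokens (node s us) ++ ○ ∷ ba) → MoveEffect t t₂ bx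
  swapEffect s us ba (m , []) _ _ ()
  swapEffect s us ba (m , _ ∷ []) _ _ ()
  swapEffect {bx = bx} s us ba (m , new ∷ old@(p , j , a) ∷ σ) st≡ (linked , _) _ src tgt =
    moveEffectOf m new old σ s after st≡
      (trans src (cong (prefixInfos bx ++_) (annotate-tokens-++ (node s us) m p j a σ ba)))
      (trans tgt (cong (prefixInfos bx ++_)
        (annotate-tokens-++ (node s us) m (proj₁ new) (proj₁ (proj₂ new)) (proj₂ (proj₂ new)) (old ∷ σ) (○ ∷ ba))))
      (Lk.head linked)
      (AllP.++⁺ (subst (All (λ e → suc m ≤ idx e)) (Traces.annotate≡ (infoAuxs-traces us (suc m) m (arity Sig s) 1 []))
                  (annotate-idx≥ (suc m) _ (tokens* us)))
                (All.map (NP.<-≤-trans (NP.m<m+n m (s≤s z≤n))) (annotate-idx≥ (m + deg (node s us)) σ ba)))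
    where
      after = infoAuxs m (arity Sig s) 1 (suc m) us ++ annotate (m + deg (node s us) , σ) ba

  leaf-tokens : ∀ t w → tokens t ≡ ○ ∷ w → w ≡ []
  leaf-tokens leaf w refl = refl
  leaf-tokens (node s ts) w ()

  moveEffect : ∀ t t₂ bx s us ba → tokens t ≡ bx ++ ○ ∷ tokens (node s us) ++ ba →
               tokens t₂ ≡ bx ++ tokens (node s us) ++ ○ ∷ ba → MoveEffect t t₂ bx
  moveEffect t t₂ [] s us ba src tgt with () ← leaf-tokens t _ src
  moveEffect t t₂ (○ ∷ bx) s us ba src tgt with () ← LP.++-conicalʳ bx _ (leaf-tokens t _ src)
  moveEffect t t₂ (● s₀ ∷ bx) s us ba src tgt
    with src≡ , okPrefix , okRest ← nodeInfos-prefix t (● s₀) bx _ src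
       | tgt≡ , _ , _ ← nodeInfos-prefix t₂ (● s₀) bx _ tgt =
    swapEffect s us ba (prefixState (● s₀ ∷ bx)) refl (StackInv-prefix s₀ bx okPrefix) okRest src≡ tgt≡

  edgeOf : Info → Edge {Sig}
  edgeOf e = (pa e , lp e , idx e)

  T-edgeEq-refl : ∀ e → T (edgeEq {Sig} e e)
  T-edgeEq-refl (a , b , c) =
    Equivalence.from T-∧ (NP.≡⇒≡ᵇ a a refl , Equivalence.from T-∧ (NP.≡⇒≡ᵇ b b refl , NP.≡⇒≡ᵇ c c refl))

  T-edgeEq⇒≡ : ∀ e f → T (edgeEq {Sig} e f) → e ≡ f
  T-edgeEq⇒≡ (a , b , c) (a' , b' , c') h
    with ha , hbc ← Equivalence.to (T-∧ {a ≡ᵇ a'}) h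
    with hb , hc ← Equivalence.to (T-∧ {b ≡ᵇ b'}) hbc =
    cong₂ _,_ (NP.≡ᵇ⇒≡ a a' ha) (cong₂ _,_ (NP.≡ᵇ⇒≡ b b' hb) (NP.≡ᵇ⇒≡ c c' hc))

  memberᵇ-∈ : ∀ {e E} → e ∈ E → T (memberᵇ {Sig} e E)
  memberᵇ-∈ {e} (here refl) = Equivalence.from T-∨ (inj₁ (T-edgeEq-refl e))
  memberᵇ-∈ (there e∈E) = Equivalence.from T-∨ (inj₂ (memberᵇ-∈ e∈E))

  memberᵇ-∉ : ∀ {e E} → All (e ≢_) E → ¬ T (memberᵇ {Sig} e E)
  memberᵇ-∉ {e} {f ∷ E} (e≢f All.∷ e∉E) h with Equivalence.to T-∨ h
  ... | inj₁ e≈f = e≢f (T-edgeEq⇒≡ e f e≈f)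
  ... | inj₂ e∈E = memberᵇ-∉ e∉E e∈E

  label-from-filter : ∀ (t₁ t₂ : Tm) x xs → filterᵇ (λ e → not (memberᵇ {Sig} e (edges t₂))) (edges t₁) ≡ x ∷ xs →
                      label t₁ t₂ ≡ (+ proj₂ (proj₂ x) , + proj₁ x , - (+ proj₁ (proj₂ x)))
  label-from-filter t₁ t₂ x xs eq rewrite eq = refl

  label-first-missing : ∀ t₁ t₂ A i₁ j i B → edges t₁ ≡ A ++ (i₁ , j , i) ∷ B →
    All (λ e → T (memberᵇ e (edges t₂))) A → ¬ T (memberᵇ (i₁ , j , i) (edges t₂)) → label t₁ t₂ ≡ (+ i , + i₁ , - (+ j))
  label-first-missing t₁ t₂ A i₁ j i B eq A⊆ e∉ =
    label-from-filter t₁ t₂ (i₁ , j , i) _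
      (trans (cong (filterᵇ _) eq) (filterᵇ-first-accepted _ A _ B (All.map T⇒¬T-not A⊆) (¬T⇒T-not e∉)))

  ⊐⇒parent-edge≢ : ∀ {x y} → x ⊐ y → (proj₁ y , proj₁ (proj₂ y)) ≢ (proj₁ x , proj₁ (proj₂ x))
  ⊐⇒parent-edge≢ (inj₁ lt) eq = NP.<-irrefl (cong proj₁ eq) lt
  ⊐⇒parent-edge≢ (inj₂ (_ , _ , lt , _)) eq = NP.<-irrefl (sym (cong proj₂ eq)) lt

  -- The label (i , i₁ , - j) of a move detaching node i = p + 1 from the slot (i₁ , j , _).
  labelAt : ℕ → Slot → ℤ × ℤ × ℤ
  labelAt p (q , j , _) = (+ suc p , + q , - (+ j))

  slots : Tm → List Slot
  slots t = map slotOf (nodeInfos t)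

  slotAt : List Slot → ℕ → Slot
  slotAt [] i = (0 , 0 , 0)
  slotAt (x ∷ l) zero = x
  slotAt (x ∷ l) (suc i) = slotAt l i

  slotAt-middle : ∀ A (s : Slot) B → slotAt (A ++ s ∷ B) (length A) ≡ s
  slotAt-middle [] s B = refl
  slotAt-middle (x ∷ A) s B = slotAt-middle A s B

  slotAt-elsewhere : ∀ A (s s' : Slot) B i → i ≢ length A → slotAt (A ++ s ∷ B) i ≡ slotAt (A ++ s' ∷ B) i
  slotAt-elsewhere [] s s' B zero ne = ⊥-elim (ne refl)
  slotAt-elsewhere [] s s' B (suc i) ne = refl
  slotAt-elsewhere (x ∷ A) s s' B zero ne = refl
  slotAt-elsewhere (x ∷ A) s s' B (suc i) ne = slotAt-elsewhere A s s' B i (λ e → ne (cong suc e))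

  slotAt-prefix : ∀ A B B' i → i < length A → slotAt (A ++ B) i ≡ slotAt (A ++ B') i
  slotAt-prefix (x ∷ A) B B' zero lt = refl
  slotAt-prefix (x ∷ A) B B' (suc i) (s≤s lt) = slotAt-prefix A B B' i lt

  record StepAt (x x' : Tm) (p : ℕ) : Set where
    constructor mkStep
    field
      prefix suffix : List Slot
      old new : Slot
      slots-source : slots x ≡ prefix ++ old ∷ suffix
      slots-target : slots x' ≡ prefix ++ new ∷ suffix
      length-prefix : length prefix ≡ p
      new⊐old : new ⊐ old
      dc≡ : dc x' ≡ dc x
      label≡ : label x x' ≡ labelAt p old

  module _ {t t₂ bx} (E : MoveEffect t t₂ bx) where
    open MoveEffect E

    moveEffect-idx : m ≡ suc (length (prefixInfos bx))
    moveEffect-idx = trans (cong proj₁ (sym prefixState≡)) (run-counter 1 (rootStack bx) bx)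

    moveEffect-label : label t t₂ ≡ labelAt (length (prefixInfos bx)) old
    moveEffect-label =
      trans (label-first-missing t t₂ (map edgeOf P) (proj₁ old) (proj₁ (proj₂ old)) m (map edgeOf after)
               (edges≡ {t} source≡) prefix-kept old-edge-lost)
            (cong (λ i → (+ i , + proj₁ old , - (+ proj₁ (proj₂ old)))) moveEffect-idx)
      where
        P = prefixInfos bx
        edges≡ : ∀ {t' slot} → nodeInfos t' ≡ P ++ infoAt movedDec slot m ∷ after →
                 edges t' ≡ map edgeOf P ++ edgeOf (infoAt movedDec slot m) ∷ map edgeOf after
        edges≡ {slot = slot} eq = trans (cong (map edgeOf) eq) (LP.map-++ edgeOf P (infoAt movedDec slot m ∷ after))
        P-idx< : All (λ e → idx e < m) P
        P-idx< = subst (λ st → All (λ e → idx e < proj₁ st) P) prefixState≡ (annotate-idx< 1 (rootStack bx) bx)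
        prefix-kept : All (λ e → T (memberᵇ e (edges t₂))) (map edgeOf P)
        prefix-kept = AllP.map⁺ (All.tabulate (λ e∈P → memberᵇ-∈
                        (subst (_ ∈_) (sym (edges≡ {t₂} target≡)) (∈-++⁺ˡ (∈-map⁺ edgeOf e∈P)))))
        old-edge-lost : ¬ T (memberᵇ (proj₁ old , proj₁ (proj₂ old) , m) (edges t₂))
        old-edge-lost = memberᵇ-∉ (subst (All (_ ≢_)) (sym (edges≡ {t₂} target≡))
          (AllP.++⁺ (AllP.map⁺ (All.map (λ i<m eq → NP.<-irrefl (sym (cong (proj₂ ∘ proj₂) eq)) i<m) P-idx<))
                    (⊐⇒parent-edge≢ new⊐old ∘ cong (λ e → (proj₁ e , proj₁ (proj₂ e)))
                       All.∷ AllP.map⁺ (All.map (λ m<i eq → NP.<-irrefl (cong (proj₂ ∘ proj₂) eq) m<i) after-idx>))))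

    moveEffect-step : StepAt t t₂ (length (prefixInfos bx))
    moveEffect-step =
      mkStep (map slotOf P) (map slotOf after) old new
        (trans (cong (map slotOf) source≡) (LP.map-++ slotOf P _))
        (trans (cong (map slotOf) target≡) (LP.map-++ slotOf P _))
        (LP.length-map slotOf P)
        new⊐old
        (trans (cong (map dec) target≡) (trans (LP.map-++ dec P _) (sym (trans (cong (map dec) source≡) (LP.map-++ dec P _)))))
        moveEffect-label
      where P = prefixInfos bx

  step-with-shape : ∀ {x x'} (h : x ⟶ x') → Σ (MoveShape x x') λ m → StepAt x x' (#nodes (MoveShape.before m))
  step-with-shape {x} {x'} h with m@(moveShape bx s us ba src tgt) ← shapeOfMove h =
    m , subst (StepAt x x') (length-prefixInfos bx) (moveEffect-step (moveEffect x x' bx s us ba src tgt))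

  stepPosition : ∀ {x x'} (h : x ⟶ x') → Σ ℕ (StepAt x x')
  stepPosition h = _ , proj₂ (step-with-shape h)

  cnc≡slotCncs : ∀ (t : Tm) → cnc t ≡ map slotCnc (slots t)
  cnc≡slotCncs t = LP.map-∘ (nodeInfos t)

  ⪯-refl : ∀ (x : Tm) → x ⪯ x
  ⪯-refl x = refl , PW.refl QP.≤-refl

  ⪯-trans : ∀ {x y z : Tm} → x ⪯ y → y ⪯ z → x ⪯ z
  ⪯-trans (dc₁ , cnc₁) (dc₂ , cnc₂) = trans dc₁ dc₂ , PW.transitive QP.≤-trans cnc₁ cnc₂

  step⇒⪯ : ∀ {x x' : Tm} {p} → StepAt x x' p → x ⪯ x'
  step⇒⪯ {x} {x'} (mkStep A B old new src tgt _ new⊐old dc≡ _) =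
    sym dc≡ , subst₂ (Pointwise ℚ._≤_) (sym (cnc-split x src)) (sym (cnc-split x' tgt))
                (PW.++⁺ (PW.refl QP.≤-refl) (QP.<⇒≤ (⊐⇒cnc> new⊐old) ∷ PW.refl QP.≤-refl))
    where
      cnc-split : ∀ t {s} → slots t ≡ A ++ s ∷ B → cnc t ≡ map slotCnc A ++ slotCnc s ∷ map slotCnc B
      cnc-split t {s} eq = trans (cnc≡slotCncs t) (trans (cong (map slotCnc) eq) (LP.map-++ slotCnc A (s ∷ B)))

  chain⇒⪯ : ∀ {x y : Tm} {c} → SatChain x y c → x ⪯ y
  chain⇒⪯ {x} single = ⪯-refl x
  chain⇒⪯ {x} {y} (step {t₂ = x'} h ch) = ⪯-trans {x} {x'} {y} (step⇒⪯ (proj₂ (stepPosition h))) (chain⇒⪯ ch)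

  slotAt-pointwise : ∀ l l' → Pointwise (λ a b → slotCnc a ℚ.≤ slotCnc b) l l' → ∀ i → slotCnc (slotAt l i) ℚ.≤ slotCnc (slotAt l' i)
  slotAt-pointwise [] [] pw i = QP.≤-refl
  slotAt-pointwise (x ∷ l) (y ∷ l') (h ∷ pw) zero = h
  slotAt-pointwise (x ∷ l) (y ∷ l') (h ∷ pw) (suc i) = slotAt-pointwise l l' pw i

  ⪯⇒slotAt-cnc≤ : ∀ {x y : Tm} → x ⪯ y → ∀ i → slotCnc (slotAt (slots x) i) ℚ.≤ slotCnc (slotAt (slots y) i)
  ⪯⇒slotAt-cnc≤ {x} {y} (_ , cnc≤) =
    slotAt-pointwise (slots x) (slots y)
      (PW.map⁻ slotCnc slotCnc (subst₂ (Pointwise ℚ._≤_) (cnc≡slotCncs x) (cnc≡slotCncs y) cnc≤))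

  step-old-slot : ∀ {x x' : Tm} {p} (st : StepAt x x' p) → slotAt (slots x) p ≡ StepAt.old st
  step-old-slot (mkStep A B s s' e1 e2 refl r _ _) = trans (cong (λ z → slotAt z (length A)) e1) (slotAt-middle A s B)

  step-new-slot : ∀ {x x' : Tm} {p} (st : StepAt x x' p) → slotAt (slots x') p ≡ StepAt.new st
  step-new-slot (mkStep A B s s' e1 e2 refl r _ _) = trans (cong (λ z → slotAt z (length A)) e2) (slotAt-middle A s' B)

  step-other-slot : ∀ {x x' : Tm} {p} (st : StepAt x x' p) → ∀ i → i ≢ p → slotAt (slots x') i ≡ slotAt (slots x) i
  step-other-slot {x} {x'} (mkStep A B s s' e1 e2 refl r _ _) i ne =
    trans (cong (λ z → slotAt z i) e2) (trans (slotAt-elsewhere A s' s B i ne) (cong (λ z → slotAt z i) (sym e1)))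

  step-strict : ∀ {x x' y : Tm} {p} → StepAt x x' p → x' ⪯ y → slotCnc (slotAt (slots x) p) ℚ.< slotCnc (slotAt (slots y) p)
  step-strict {x} {x'} {y} {p} st le =
    subst (λ z → slotCnc z ℚ.< slotCnc (slotAt (slots y) p)) (sym (step-old-slot st))
      (QP.<-≤-trans (⊐⇒cnc> (StepAt.new⊐old st))
        (subst (λ z → slotCnc z ℚ.≤ slotCnc (slotAt (slots y) p)) (step-new-slot st) (⪯⇒slotAt-cnc≤ {x'} {y} le p)))

  stepPosition-unique : ∀ {x x' p q} → StepAt x x' p → StepAt x x' q → p ≡ q
  stepPosition-unique {p = p} {q} stp stq with p NP.≟ q
  ... | yes p≡q = p≡q
  ... | no p≢q = ⊥-elim (⊐-irrefl (subst (_⊐ StepAt.old stp) new≡old (StepAt.new⊐old stp)))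
    where
      new≡old : StepAt.new stp ≡ StepAt.old stp
      new≡old = trans (sym (step-new-slot stp)) (trans (step-other-slot stq p p≢q) (step-old-slot stp))

  step-deterministic : ∀ {x x₁ x₂ p} (h₁ : x ⟶ x₁) (h₂ : x ⟶ x₂) → StepAt x x₁ p → StepAt x x₂ p → x₁ ≡ x₂
  step-deterministic {x} {x₁} {x₂} h₁ h₂ st₁ st₂
    with moveShape bx₁ s₁ us₁ ba₁ src₁ tgt₁ , st₁' ← step-with-shape h₁
       | moveShape bx₂ s₂ us₂ ba₂ src₂ tgt₂ , st₂' ← step-with-shape h₂
    with refl ← move-prefix-unique bx₁ bx₂ _ _ s₁ s₂ (trans (sym src₁) src₂)
                  (trans (stepPosition-unique st₁' st₁) (sym (stepPosition-unique st₂' st₂)))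
    with refl , refl ← tokens-++-injective (node s₁ us₁) (node s₂ us₂) ba₁ ba₂
                         (LP.∷-injectiveʳ (LP.++-cancelˡ bx₁ _ _ (trans (sym src₁) src₂)))
    = tokens-injective x₁ x₂ (trans tgt₁ (sym tgt₂))

  slotCnc<⇒≢ : ∀ {a b : Slot} → slotCnc a ℚ.< slotCnc b → a ≡ b → ⊥
  slotCnc<⇒≢ a<b refl = QP.<-irrefl refl a<b

  no-loop : ∀ {x z : Tm} {c} → x ⟶ z → SatChain z x c → ⊥
  no-loop {x} {z} h ch = QP.<-irrefl refl (step-strict {x} {z} {x} (proj₂ (stepPosition h)) (chain⇒⪯ ch))

  -- Comparing annotations

  pop-drop : ∀ k (σ : List Slot) → List.drop k (pop σ) ≡ List.drop (suc k) σ
  pop-drop k [] = LP.drop-[] k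
  pop-drop k (x ∷ σ) = refl

  annotate-leaves : ∀ n σ k w → annotate (n , σ) (replicate k ○ ++ w) ≡ annotate (n , List.drop k σ) w
  annotate-leaves n σ zero w = refl
  annotate-leaves n σ (suc k) w = trans (annotate-leaves n (pop σ) k w) (cong (λ τ → annotate (n , τ) w) (pop-drop k σ))

  annotate-only-leaves : ∀ n σ k → annotate (n , σ) (replicate k ○) ≡ []
  annotate-only-leaves n σ zero = refl
  annotate-only-leaves n σ (suc k) = annotate-only-leaves n (pop σ) k

  run-leaves : ∀ n σ k → run (n , σ) (replicate k ○) ≡ (n , List.drop k σ)
  run-leaves n σ zero = refl
  run-leaves n σ (suc k) = trans (run-leaves n (pop σ) k) (cong (n ,_) (pop-drop k σ))

  leaves-shift : ∀ k w → ○ ∷ (replicate k ○ ++ w) ≡ replicate k ○ ++ ○ ∷ w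
  leaves-shift zero w = refl
  leaves-shift (suc k) w = cong (○ ∷_) (leaves-shift k w)

  leaves-then-node : ∀ n σ w → NoUnderflow (n , σ) w → annotate (n , σ) w ≢ [] →
    Σ ℕ λ k → Σ (S Sig) λ s → Σ (List Token) λ r → Σ Slot λ z → Σ (List Slot) λ τ →
      w ≡ replicate k ○ ++ ● s ∷ r × List.drop k σ ≡ z ∷ τ
  leaves-then-node n σ [] _ nonempty = ⊥-elim (nonempty refl)
  leaves-then-node n [] (_ ∷ w) () _
  leaves-then-node n (z ∷ σ) (● s ∷ w) _ _ = 0 , s , w , z , σ , refl , refl
  leaves-then-node n (z ∷ σ) (○ ∷ w) ok nonempty with k , s , r , z' , τ , refl , eq ← leaves-then-node n σ w ok nonempty =
    suc k , s , r , z' , τ , refl , eq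

  annotate-first-slot : ∀ n σ w → NoUnderflow (n , σ) w → ∀ {e es} → annotate (n , σ) w ≡ e ∷ es → slotOf e ∈ σ
  annotate-first-slot n σ w ok {e} {es} eq
    with k , s , r , z , τ , refl , drop≡ ← leaves-then-node n σ w ok (λ empty → case trans (sym eq) empty of λ ())
    = subst (_∈ σ) (cong slotOf (LP.∷-injectiveˡ first≡)) (drop⇒∈ k σ drop≡)
    where
      first≡ : infoAt s z n ∷ annotate (suc n , childSlotsOf n (arity Sig s) ++ τ) r ≡ e ∷ es
      first≡ = trans (sym (trans (annotate-leaves n σ k (● s ∷ r)) (cong (λ τ' → annotate (n , τ') (● s ∷ r)) drop≡))) eq

  InfosLe : List Info → List Info → Set
  InfosLe = Pointwise (λ e f → dec e ≡ dec f × infoCnc e ℚ.≤ infoCnc f)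

  InfosLe-nonempty : ∀ {es f fs} → InfosLe es (f ∷ fs) → es ≢ []
  InfosLe-nonempty (_ ∷ _) ()

  -- At the first difference of w₁ and w₂, w₁ has a leaf facing a node f of w₂; the leaves of w₁ from there
  -- on are followed by a node, and moving it in front of the last of these leaves attaches it to a slot
  -- whose connection value is at most that of f.
  record Divergence (n : ℕ) (σ : List Slot) (w₁ w₂ : List Token) : Set where
    constructor divergence
    field
      before : List Token
      movedDec : S Sig
      after : List Token
      source≡ : w₁ ≡ before ++ ○ ∷ ● movedDec ∷ after
      target : Info
      targetRest : List Info
      annotate-target : annotate (n , σ) w₂ ≡ annotate (n , σ) before ++ target ∷ targetRest
      top≤target : slotCnc (top (proj₂ (run (n , σ) before))) ℚ.≤ infoCnc target

  Divergence-○ : ∀ {n x σ w₁ w₂} → Divergence n σ w₁ w₂ → Divergence n (x ∷ σ) (○ ∷ w₁) (○ ∷ w₂)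
  Divergence-○ (divergence bx s r src f fs tgt ≤f) = divergence (○ ∷ bx) s r (cong (○ ∷_) src) f fs tgt ≤f

  Divergence-● : ∀ {n x σ w₁ w₂} s → Divergence (suc n) (childSlotsOf n (arity Sig s) ++ σ) w₁ w₂ →
                 Divergence n (x ∷ σ) (● s ∷ w₁) (● s ∷ w₂)
  Divergence-● {n} {x} s (divergence bx s' r src f fs tgt ≤f) =
    divergence (● s ∷ bx) s' r (cong (● s ∷_) src) f fs (cong (infoAt s x n ∷_) tgt) ≤f

  leaf-node-divergence : ∀ n x σ k s r z τ s' w₂ → Linked _⊐_ (x ∷ σ) → List.drop k σ ≡ z ∷ τ →
    Divergence n (x ∷ σ) (○ ∷ (replicate k ○ ++ ● s ∷ r)) (● s' ∷ w₂)
  leaf-node-divergence n x σ k s r z τ s' w₂ linked drop≡ with y , drop≡' ← drop-pred k (x ∷ σ) drop≡ =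
    divergence (replicate k ○) s r (leaves-shift k (● s ∷ r)) (infoAt s' x n) rest
      (sym (cong (_++ infoAt s' x n ∷ rest) (annotate-only-leaves n (x ∷ σ) k)))
      (subst (λ st → slotCnc (top (proj₂ st)) ℚ.≤ slotCnc x) (sym (trans (run-leaves n (x ∷ σ) k) (cong (n ,_) drop≡')))
        (linked⇒top-cnc≥ linked (drop⇒∈ k (x ∷ σ) drop≡')))
    where rest = annotate (suc n , childSlotsOf n (arity Sig s') ++ σ) w₂

  compareRuns : ∀ n σ w₁ w₂ → StackInv (n , σ) → NoUnderflow (n , σ) w₁ → NoUnderflow (n , σ) w₂ →
                proj₂ (run (n , σ) w₁) ≡ [] → proj₂ (run (n , σ) w₂) ≡ [] →
                InfosLe (annotate (n , σ) w₁) (annotate (n , σ) w₂) → (w₁ ≡ w₂) ⊎ Divergence n σ w₁ w₂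
  compareRuns n [] [] [] _ _ _ _ _ _ = inj₁ refl
  compareRuns n [] [] (_ ∷ _) _ _ () _ _ _
  compareRuns n [] (_ ∷ _) _ _ () _ _ _ _
  compareRuns n (x ∷ σ) [] _ _ _ _ () _ _
  compareRuns n (x ∷ σ) (_ ∷ _) [] _ _ _ _ () _
  compareRuns n (x ∷ σ) (○ ∷ w₁) (○ ∷ w₂) (linked , below) ok₁ ok₂ end₁ end₂ le =
    Sum.map (cong (○ ∷_)) Divergence-○ (compareRuns n σ w₁ w₂ (Lk.tail linked , All.tail below) ok₁ ok₂ end₁ end₂ le)
  compareRuns n (x ∷ σ) (● s ∷ w₁) (● s' ∷ w₂) (linked , below) ok₁ ok₂ end₁ end₂ ((refl , _) ∷ le) =
    Sum.map (cong (● s ∷_)) (Divergence-● s)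
      (compareRuns (suc n) _ w₁ w₂ (StackInv-push n σ (arity Sig s) (Lk.tail linked , All.tail below)) ok₁ ok₂ end₁ end₂ le)
  compareRuns n (x ∷ σ) (○ ∷ w₁) (● s' ∷ w₂) (linked , _) ok₁ _ _ _ le
    with k , s , r , z , τ , refl , drop≡ ← leaves-then-node n σ w₁ ok₁ (InfosLe-nonempty le) =
    inj₂ (leaf-node-divergence n x σ k s r z τ s' w₂ linked drop≡)
  compareRuns n (x ∷ σ) (● s ∷ w₁) (○ ∷ w₂) (linked , _) _ ok₂ _ _ le = ⊥-elim (node-vs-leaf (annotate (n , σ) w₂) refl le)
    where
      -- w₂'s next node hangs from a slot below x, so its connection value is smaller than x's
      node-vs-leaf : ∀ fs → annotate (n , σ) w₂ ≡ fs →
                     ¬ InfosLe (infoAt s x n ∷ annotate (suc n , childSlotsOf n (arity Sig s) ++ σ) w₁) fs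
      node-vs-leaf [] _ ()
      node-vs-leaf (f ∷ fs) eq ((_ , x≤f) ∷ _) =
        QP.<-irrefl refl (QP.<-≤-trans (⊐⇒cnc> (All.lookup (linked⇒head-⊐ linked) (annotate-first-slot n σ w₂ ok₂ eq))) x≤f)

  ⪯⇒InfosLe : ∀ {x y} → x ⪯ y → InfosLe (nodeInfos x) (nodeInfos y)
  ⪯⇒InfosLe {x} {y} (dc≡ , cnc≤) = zip (nodeInfos x) (nodeInfos y) dc≡ cnc≤
    where
      zip : ∀ A B → map dec A ≡ map dec B → Pointwise ℚ._≤_ (map infoCnc A) (map infoCnc B) → InfosLe A B
      zip [] [] _ _ = []
      zip (a ∷ A) (b ∷ B) eq (a≤b ∷ A≤B) = (LP.∷-injectiveˡ eq , a≤b) ∷ zip A B (LP.∷-injectiveʳ eq) A≤B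

  AgreeBelow : Tm → Tm → ℕ → Set
  AgreeBelow x y p = ∀ i → i < p → slotAt (slots x) i ≡ slotAt (slots y) i

  GoodStep : Tm → Tm → Set
  GoodStep x y = Σ Tm λ x' → (x ⟶ x') × Σ ℕ λ p → StepAt x x' p × (x' ⪯ y) × AgreeBelow x y p

  goodStep-from : ∀ {x x' y bx} (E : MoveEffect x x' bx) f fs → nodeInfos y ≡ prefixInfos bx ++ f ∷ fs →
                  slotCnc (MoveEffect.new E) ℚ.≤ infoCnc f → x ⪯ y → (x' ⪯ y) × AgreeBelow x y (length (prefixInfos bx))
  goodStep-from {x} {x'} {y} {bx} E f fs y≡ new≤f (dc≡ , cnc≤) =
    (trans (StepAt.dc≡ (moveEffect-step E)) dc≡ , cnc'≤) , agree
    where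
      open MoveEffect E
      P = prefixInfos bx
      split : ∀ {B : Set} (g : Info → B) t {e es} → nodeInfos t ≡ P ++ e ∷ es → map g (nodeInfos t) ≡ map g P ++ g e ∷ map g es
      split g t {e} {es} eq = trans (cong (map g) eq) (LP.map-++ g P (e ∷ es))
      cnc'≤ : Pointwise ℚ._≤_ (cnc x') (cnc y)
      cnc'≤ = subst₂ (Pointwise ℚ._≤_) (sym (split infoCnc x' target≡)) (sym (split infoCnc y y≡))
        (PW.++⁺ (PW.refl QP.≤-refl)
          (new≤f ∷ PW.tail (PW.++-cancelˡ (map infoCnc P)
                              (subst₂ (Pointwise ℚ._≤_) (split infoCnc x source≡) (split infoCnc y y≡) cnc≤))))
      agree : AgreeBelow x y (length P)
      agree i i<p = trans (cong (λ ss → slotAt ss i) (split slotOf x source≡))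
                     (trans (slotAt-prefix (map slotOf P) _ _ i (subst (i <_) (sym (LP.length-map slotOf P)) i<p))
                            (cong (λ ss → slotAt ss i) (sym (split slotOf y y≡))))

  goodStep-or-equal′ : ∀ x y s₀ wx wy → tokens x ≡ ● s₀ ∷ wx → tokens y ≡ ● s₀ ∷ wy → x ⪯ y → (x ≡ y) ⊎ GoodStep x y
  goodStep-or-equal′ x y s₀ wx wy ex ey le =
    fromComparison (compareRuns 2 (rootChildren s₀) wx wy (StackInv-rootChildren s₀) (Traces.noUnderflow tx) (Traces.noUnderflow ty)
                      (cong proj₂ (Traces.run≡ tx)) (cong proj₂ (Traces.run≡ ty))
                      (PW.tail (subst₂ InfosLe (sym (Traces.annotate≡ tx)) (sym (Traces.annotate≡ ty)) (⪯⇒InfosLe {x} {y} le))))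
    where
      tx : Traces (initial (● s₀ ∷ wx)) (● s₀ ∷ wx) (nodeInfos x) (1 + deg x , [])
      tx = subst (λ w → Traces (initial w) w (nodeInfos x) (1 + deg x , [])) ex (nodeInfos-traces x)
      ty : Traces (initial (● s₀ ∷ wy)) (● s₀ ∷ wy) (nodeInfos y) (1 + deg y , [])
      ty = subst (λ w → Traces (initial w) w (nodeInfos y) (1 + deg y , [])) ey (nodeInfos-traces y)
      fromMove : ∀ bx f fs → nodeInfos y ≡ prefixInfos (● s₀ ∷ bx) ++ f ∷ fs →
                 slotCnc (top (proj₂ (prefixState (● s₀ ∷ bx)))) ℚ.≤ infoCnc f →
                 Σ Tm (λ x' → (x ⟶ x') × Σ (MoveShape x x') (λ m → MoveShape.before m ≡ ● s₀ ∷ bx)) → GoodStep x y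
      fromMove bx f fs y≡ top≤f (x' , x⟶x' , moveShape _ ms mus ba src tgt , refl) =
        x' , x⟶x' , _ , moveEffect-step E ,
        goodStep-from {y = y} E f fs y≡ (subst (λ st → slotCnc (top (proj₂ st)) ℚ.≤ infoCnc f) (MoveEffect.prefixState≡ E) top≤f) le
        where E = moveEffect x x' (● s₀ ∷ bx) ms mus ba src tgt
      fromComparison : (wx ≡ wy) ⊎ Divergence 2 (rootChildren s₀) wx wy → (x ≡ y) ⊎ GoodStep x y
      fromComparison (inj₁ wx≡wy) = inj₁ (tokens-injective x y (trans ex (trans (cong (● s₀ ∷_) wx≡wy) (sym ey))))
      fromComparison (inj₂ (divergence bx s r wx≡ f fs wy≡ top≤f)) =
        inj₂ (fromMove bx f fs (trans (sym (Traces.annotate≡ ty)) (cong (infoAt s₀ (1 , 0 , arity Sig s₀) 1 ∷_) wy≡)) top≤f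
                (move-from-tokens x (● s₀ ∷ bx) s r (trans ex (cong (● s₀ ∷_) wx≡))))

  goodStep-or-equal : ∀ x y → x ⪯ y → (x ≡ y) ⊎ GoodStep x y
  goodStep-or-equal leaf leaf le = inj₁ refl
  goodStep-or-equal leaf (node s ts) (() , _)
  goodStep-or-equal (node s ts) leaf (() , _)
  goodStep-or-equal (node s₀ ts) (node s₁ ts') le =
    goodStep-or-equal′ (node s₀ ts) (node s₁ ts') s₀ (tokens* ts) (tokens* ts') refl
      (cong (λ q → ● q ∷ tokens* ts') (sym (proj₁ (∷-injective (proj₁ le))))) le

  -- Saturated chains

  labels-∷ : ∀ {x x' y : Tm} {cs} → SatChain x' y cs → labels (x ∷ cs) ≡ label x x' ∷ labels cs
  labels-∷ single = refl
  labels-∷ (step h ch) = refl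

  step-label-position : ∀ {x x' : Tm} {p} (st : StepAt x x' p) → proj₁ (label x x') ≡ + suc p
  step-label-position st = cong proj₁ (StepAt.label≡ st)

  unlabelled-slot-preserved : ∀ {x y : Tm} {c} q → SatChain x y c → All (λ l → proj₁ l ≢ + suc q) (labels c) →
                              slotAt (slots x) q ≡ slotAt (slots y) q
  unlabelled-slot-preserved q single _ = refl
  unlabelled-slot-preserved {x} q (step {t₂ = x'} h ch) avoids
    with first≢ All.∷ rest ← subst (All (λ l → proj₁ l ≢ + suc q)) (labels-∷ {x = x} ch) avoids
    with p , st ← stepPosition h =
    trans (sym (step-other-slot st q (λ q≡p → first≢ (trans (step-label-position st) (cong (λ i → + suc i) (sym q≡p))))))
          (unlabelled-slot-preserved q ch rest)

  _<L_ : Label {Sig} → Label {Sig} → Set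
  _<L_ = _<ᴸ_ {Sig}

  _≤L_ : Label {Sig} → Label {Sig} → Set
  _≤L_ = _≤ᴸ_ {Sig}

  <ᴸ⇒position≤ : ∀ {a b : Label {Sig}} → a <L b → proj₁ a ℤ.≤ proj₁ b
  <ᴸ⇒position≤ (inj₁ lt) = ZP.<⇒≤ lt
  <ᴸ⇒position≤ (inj₂ (eq , _)) = ZP.≤-reflexive eq

  ≤ᴸ⇒position≤ : ∀ {a b : Label {Sig}} → a ≤L b → proj₁ a ℤ.≤ proj₁ b
  ≤ᴸ⇒position≤ (inj₁ lt) = <ᴸ⇒position≤ lt
  ≤ᴸ⇒position≤ (inj₂ refl) = ZP.≤-refl

  increasing⇒positions≥ : ∀ {l ls} → Linked _<L_ (l ∷ ls) → All (λ l' → proj₁ l ℤ.≤ proj₁ l') ls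
  increasing⇒positions≥ {ls = []} _ = All.[]
  increasing⇒positions≥ {ls = _ ∷ _} (l<l' Lk.∷ rest) =
    <ᴸ⇒position≤ l<l' All.∷ All.map (ZP.≤-trans (<ᴸ⇒position≤ l<l')) (increasing⇒positions≥ rest)

  decreasing⇒positions≤ : ∀ {l ls} → Linked (λ a b → b ≤L a) (l ∷ ls) → All (λ l' → proj₁ l' ℤ.≤ proj₁ l) ls
  decreasing⇒positions≤ {ls = []} _ = All.[]
  decreasing⇒positions≤ {ls = _ ∷ _} (l'≤l Lk.∷ rest) =
    ≤ᴸ⇒position≤ l'≤l All.∷ All.map (λ le → ZP.≤-trans le (≤ᴸ⇒position≤ l'≤l)) (decreasing⇒positions≤ rest)

  labelAt-<-position : ∀ {p p'} s s' → p < p' → labelAt p s <L labelAt p' s'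
  labelAt-<-position s s' p<p' = inj₁ (ℤ.+<+ (s≤s p<p'))

  labelAt-<-slot : ∀ p {s s'} → s' ⊐ s → labelAt p s <L labelAt p s'
  labelAt-<-slot p (inj₁ lt) = inj₂ (refl , inj₁ (ℤ.+<+ lt))
  labelAt-<-slot p (inj₂ (refl , refl , j<j' , _)) = inj₂ (refl , inj₂ (refl , ZP.neg-mono-< (ℤ.+<+ j<j')))

  -- All later positions of an increasing chain are at least its first one, so it never changes a slot to the left.
  increasing-agrees-below : ∀ {x x' y cs p} (h : x ⟶ x') (ch : SatChain x' y cs) → λ-increasing (x ∷ cs) → StepAt x x' p →
                            AgreeBelow x y p
  increasing-agrees-below {x} {x'} {cs = cs} {p} h ch inc st q q<p =
    unlabelled-slot-preserved q (step h ch)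
      (subst (All (λ l → proj₁ l ≢ + suc q)) (sym (labels-∷ {x = x} ch))
        (avoid {label x x'} ZP.≤-refl All.∷
           All.map (λ {l} → avoid {l}) (increasing⇒positions≥ (subst (Linked _<L_) (labels-∷ {x = x} ch) inc))))
    where
      avoid : ∀ {l : Label {Sig}} → proj₁ (label x x') ℤ.≤ proj₁ l → proj₁ l ≢ + suc q
      avoid first≤l refl = NP.<⇒≱ q<p (ℕ.s≤s⁻¹ (ZP.drop‿+≤+ (subst (ℤ._≤ + suc q) (step-label-position st) first≤l)))

  decreasing-agrees-above : ∀ {x x' y cs p} (h : x ⟶ x') (ch : SatChain x' y cs) → λ-weaklyDecreasing (x ∷ cs) → StepAt x x' p →
                            ∀ q → p < q → slotAt (slots x) q ≡ slotAt (slots y) q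
  decreasing-agrees-above {x} {x'} {cs = cs} {p} h ch dec st q p<q =
    unlabelled-slot-preserved q (step h ch)
      (subst (All (λ l → proj₁ l ≢ + suc q)) (sym (labels-∷ {x = x} ch))
        (avoid {label x x'} ZP.≤-refl All.∷
           All.map (λ {l} → avoid {l}) (decreasing⇒positions≤ (subst (Linked (λ a b → b ≤L a)) (labels-∷ {x = x} ch) dec))))
    where
      avoid : ∀ {l : Label {Sig}} → proj₁ l ℤ.≤ proj₁ (label x x') → proj₁ l ≢ + suc q
      avoid l≤first refl = NP.<⇒≱ p<q (ℕ.s≤s⁻¹ (ZP.drop‿+≤+ (subst (+ suc q ℤ.≤_) (step-label-position st) l≤first)))

  increasing-tail : ∀ {x x' y : Tm} {cs} → SatChain x' y cs → λ-increasing (x ∷ cs) → λ-increasing cs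
  increasing-tail {x} ch ic = Lk.tail (subst (Linked _<L_) (labels-∷ {x = x} ch) ic)

  decreasing-tail : ∀ {x x' y : Tm} {cs} → SatChain x' y cs → λ-weaklyDecreasing (x ∷ cs) → λ-weaklyDecreasing cs
  decreasing-tail {x} ch ic = Lk.tail (subst (Linked (λ a b → b ≤L a)) (labels-∷ {x = x} ch) ic)

  -- Of two chains starting at positions p < p', the one at p changes slot p for good,
  -- while an increasing chain starting at p' never touches it.
  increasing-unique : ∀ {x y : Tm} {c c'} → SatChain x y c → λ-increasing c → SatChain x y c' → λ-increasing c' → c' ≡ c
  increasing-unique single ic single ic' = refl
  increasing-unique single ic (step h' ch') ic' = ⊥-elim (no-loop h' ch')
  increasing-unique (step h ch) ic single ic' = ⊥-elim (no-loop h ch)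
  increasing-unique {x} {y} (step {t₂ = x₁} h ch) ic (step {t₂ = x₂} h' ch') ic' with stepPosition h | stepPosition h'
  ... | p , st | p' , st' with NP.<-cmp p p'
  ... | tri< lt _ _ = ⊥-elim (slotCnc<⇒≢ (step-strict {x} {x₁} {y} st (chain⇒⪯ ch)) (increasing-agrees-below h' ch' ic' st' p lt))
  ... | tri> _ _ gt = ⊥-elim (slotCnc<⇒≢ (step-strict {x} {x₂} {y} st' (chain⇒⪯ ch')) (increasing-agrees-below h ch ic st p' gt))
  ... | tri≈ _ refl _ with step-deterministic h h' st st'
  ... | refl = cong (x ∷_) (increasing-unique ch (increasing-tail {x} ch ic) ch' (increasing-tail {x} ch' ic'))

  decreasing-unique : ∀ {x y : Tm} {c c'} → SatChain x y c → λ-weaklyDecreasing c → SatChain x y c' → λ-weaklyDecreasing c' → c ≡ c'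
  decreasing-unique single ic single ic' = refl
  decreasing-unique single ic (step h' ch') ic' = ⊥-elim (no-loop h' ch')
  decreasing-unique (step h ch) ic single ic' = ⊥-elim (no-loop h ch)
  decreasing-unique {x} {y} (step {t₂ = x₁} h ch) ic (step {t₂ = x₂} h' ch') ic' with stepPosition h | stepPosition h'
  ... | p , st | p' , st' with NP.<-cmp p p'
  ... | tri< lt _ _ = ⊥-elim (slotCnc<⇒≢ (step-strict {x} {x₂} {y} st' (chain⇒⪯ ch')) (decreasing-agrees-above h ch ic st p' lt))
  ... | tri> _ _ gt = ⊥-elim (slotCnc<⇒≢ (step-strict {x} {x₁} {y} st (chain⇒⪯ ch)) (decreasing-agrees-above h' ch' ic' st' p gt))
  ... | tri≈ _ refl _ with step-deterministic h h' st st'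
  ... | refl = cong (x ∷_) (decreasing-unique ch (decreasing-tail {x} ch ic) ch' (decreasing-tail {x} ch' ic'))

  increasing-least : ∀ {x y : Tm} {c c'} → SatChain x y c → λ-increasing c → SatChain x y c' → c' ≢ c → λ-smaller c c'
  increasing-least single ic single ne = ⊥-elim (ne refl)
  increasing-least single ic (step h' ch') ne = ⊥-elim (no-loop h' ch')
  increasing-least (step h ch) ic single ne = ⊥-elim (no-loop h ch)
  increasing-least {x} {y} (step {t₂ = x₁} h ch) ic (step {t₂ = x₂} h' ch') ne with stepPosition h | stepPosition h'
  ... | p , st | p' , st' with NP.<-cmp p p'
  ... | tri< lt _ _ = subst₂ (Lex-< _≡_ _<L_) (sym (labels-∷ {x = x} ch)) (sym (labels-∷ {x = x} ch'))
                        (this (subst₂ _<L_ (sym (StepAt.label≡ st)) (sym (StepAt.label≡ st'))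
                                 (labelAt-<-position (StepAt.old st) (StepAt.old st') lt)))
  ... | tri> _ _ gt = ⊥-elim (slotCnc<⇒≢ (step-strict {x} {x₂} {y} st' (chain⇒⪯ ch')) (increasing-agrees-below h ch ic st p' gt))
  ... | tri≈ _ refl _ with step-deterministic h h' st st'
  ... | refl = subst₂ (Lex-< _≡_ _<L_) (sym (labels-∷ {x = x} ch)) (sym (labels-∷ {x = x} ch'))
                 (next refl (increasing-least ch (increasing-tail {x} ch ic) ch' (λ e → ne (cong (x ∷_) e))))

  -- Whatever step follows a good step towards y lies at the same or a later position (slots before p already agree
  -- with y), and at the same position it starts from the slot the good step moved to.
  goodStep-label< : ∀ {x x' x₂ y cs p} → StepAt x x' p → AgreeBelow x y p → x' ⟶ x₂ → SatChain x₂ y cs →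
                    label x x' <L label x' x₂
  goodStep-label< {x} {x'} {y = y} {p = p} st agree h₂ ch₂ with p₂ , st₂ ← stepPosition h₂ with NP.<-cmp p p₂
  ... | tri< p<p₂ _ _ =
    subst₂ _<L_ (sym (StepAt.label≡ st)) (sym (StepAt.label≡ st₂)) (labelAt-<-position (StepAt.old st) (StepAt.old st₂) p<p₂)
  ... | tri≈ _ refl _ =
    subst₂ _<L_ (sym (StepAt.label≡ st)) (sym (StepAt.label≡ st₂))
      (subst (λ z → labelAt p (StepAt.old st) <L labelAt p z) (trans (sym (step-new-slot st)) (step-old-slot st₂))
        (labelAt-<-slot p (StepAt.new⊐old st)))
  ... | tri> _ _ p₂<p = ⊥-elim (slotCnc<⇒≢ (step-strict {x'} {_} {y} st₂ (chain⇒⪯ ch₂))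
                                 (trans (step-other-slot st p₂ (λ p₂≡p → NP.<-irrefl p₂≡p p₂<p)) (agree p₂ p₂<p)))

  increasing-∷ : ∀ {x x' y c} → (∀ {x₂ cs} → x' ⟶ x₂ → SatChain x₂ y cs → label x x' <L label x' x₂) →
                 SatChain x' y c → λ-increasing c → λ-increasing (x ∷ c)
  increasing-∷ _ single _ = Lk.[-]
  increasing-∷ {x} {x'} first< (step h ch) inc =
    subst (Linked _<L_) (sym (cong (label x x' ∷_) (labels-∷ {x = x'} ch)))
      (first< h ch Lk.∷ subst (Linked _<L_) (labels-∷ {x = x'} ch) inc)

  increasingChain : ∀ n (x y : Tm) → inversions (tokens x) < n → x ⪯ y → Σ (List Tm) λ c → SatChain x y c × λ-increasing c
  increasingChain zero x y () _
  increasingChain (suc n) x y bound x⪯y with goodStep-or-equal x y x⪯y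
  ... | inj₁ refl = (x ∷ []) , single , Lk.[]
  ... | inj₂ (x' , h , p , st , x'⪯y , agree)
    with c , ch , inc ← increasingChain n x' y (NP.≤-trans (move-decreases-inversions h) (NP.≤-pred bound)) x'⪯y =
    (x ∷ c) , step h ch , increasing-∷ (goodStep-label< st agree) ch inc

theorem3p1p5 : (Sig : Signature) →
    IsEL-labeling {Sig} × AtMostOneWeaklyDecreasing {Sig}
theorem3p1p5 Sig = isEL , atMostOne
  where
    isEL : IsEL-labeling {Sig}
    isEL x x' x⪯x' with c , ch , inc ← increasingChain {Sig} (suc (inversions (tokens x))) x x' NP.≤-refl x⪯x' =
      c , ch , inc , (λ c' ch' inc' → increasing-unique ch inc ch' inc') , (λ c' ch' c'≢c → increasing-least ch inc ch' c'≢c)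
    atMostOne : AtMostOneWeaklyDecreasing {Sig}
    atMostOne x x' _ c c' ch dec ch' dec' = decreasing-unique ch dec ch' dec'
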